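{- Let $p$ be a prime and let $A,B\subset GF(p)$ be disjoint sets with $|A|\ge2$ and $|B|\ge2$, such that each of the difference sets $A-A$, $A-B$, $B-B$, apart from $0$, consists either only of nonzero squares or only of non-squares in $GF(p)$ (the type may differ between the three sets). Then \[\min\{|A|^2-2|A|,\ |B|^2-2|B|\}+|A||B|+2\le \frac{p+3}{2}.\]
   Context: $X-Y=\{x-y: x\in X, y\in Y\}$. A non-square is a nonzero element of $GF(p)$ that is not a square. -}

module Defs where

open import Data.Nat using (ℕ; _+_; _*_; _%_; NonZero)
open import Data.Fin using (Fin; toℕ)
open import Data.Fin.Subset using (Subset; _∈_)
open import Data.Product using (∃)
open import Data.Sum using (_⊎_)
open import Relation.Nullary using (¬_)
open import Relation.Binary.PropositionalEquality using (_≡_; _≢_)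

-- GF(p) is modelled as Fin p with arithmetic modulo p.
-- "x - y is a square in GF(p)":  ∃ z, z*z ≡ x - y  (mod p), written as z*z + y ≡ x (mod p).
IsSquareDiff : (p : ℕ) .{{_ : NonZero p}} → Fin p → Fin p → Set
IsSquareDiff p x y = ∃ λ (z : Fin p) → (toℕ z * toℕ z + toℕ y) % p ≡ toℕ x % p

AllNonzeroSquares : (p : ℕ) .{{_ : NonZero p}} → Subset p → Subset p → Set
AllNonzeroSquares p S T =
  ∀ x y → x ∈ S → y ∈ T → x ≢ y → IsSquareDiff p x y

AllNonSquares : (p : ℕ) .{{_ : NonZero p}} → Subset p → Subset p → Set
AllNonSquares p S T =
  ∀ x y → x ∈ S → y ∈ T → x ≢ y → ¬ IsSquareDiff p x y

Homogeneous : (p : ℕ) .{{_ : NonZero p}} → Subset p → Subset p → Set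
Homogeneous p S T = AllNonzeroSquares p S T ⊎ AllNonSquares p S T

module Submission where

-- Write p = 2d + 1, so that x ↦ xᵈ is the quadratic character modulo p. For distinct points
-- c ∈ S, |S| = m + 2 ≤ d + 2, with signs ε_c = ±1 and Lagrange weights u_c = ∏_{c′ ≠ c} (c - c′)⁻¹,
-- let F = Σ_c ε_c u_c (X - c)ᵈ⁺ᵐ. As Σ_c u_c g(c) is the coefficient of Xᵐ⁺¹ in every g of degree
-- at most m + 1, F vanishes to order m at each x with (x - c)ᵈ = α ε_c for all c ∈ S ∖ {x}.
-- F is nonzero modulo p by the Vandermonde argument, and when all ε_c = 1 it has degree d - 1.
-- Counting roots with multiplicity, a set X of such points has |X| m ≤ d + m, resp. |X| m < d.
-- According to which two of the characters on A - A, A - B, B - B agree, S = A ∪ B is signed and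
-- X = A ∪ B, A or B; each case yields min(|A|² - 2|A|, |B|² - 2|B|) + |A||B| ≤ d.

open import Data.Nat as ℕ using (ℕ; zero; suc; z≤n; s≤s; _!; _%_)
open import Data.Nat.DivMod using (m%n<n; m≡m%n+[m/n]*n)
import Data.Nat.Properties as ℕₚ
import Data.Nat.Tactic.RingSolver as ℕ-Ring
import Data.Nat.Divisibility as ℕᵈ
open import Data.Nat.Primality using (Prime; euclidsLemma; prime⇒nonTrivial; prime⇒nonZero; composite; composite⇒¬prime)
open import Relation.Binary.Definitions using (tri<; tri≈; tri>)
open import Data.Fin as Fin using (Fin; toℕ; fromℕ<)
import Data.Fin.Properties as Finₚ
open import Data.List using (List; []; _∷_; length; replicate; map; take; _++_)
open import Data.Nat.ListAction using (sum)
open import Data.List.Relation.Unary.Any using (here; there)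
open import Data.List.Membership.Propositional using () renaming (_∈_ to _∈ᴸ_)
open import Data.List.Membership.Propositional.Properties using (∈-++⁺ˡ; ∈-++⁺ʳ; ∈-++⁻; ∈-map⁻)
import Data.List.Properties as Listₚ
open import Data.List.Relation.Unary.All using (All; []; _∷_)
import Data.List.Relation.Unary.All as All
import Data.List.Relation.Unary.All.Properties as Allₚ
open import Data.List.Relation.Unary.AllPairs as AllPairs using (AllPairs; []; _∷_)
import Data.List.Relation.Unary.AllPairs.Properties as AllPairsₚ
open import Data.Sum as Sum using (_⊎_; inj₁; inj₂)
open import Data.Empty using (⊥; ⊥-elim)
open import Data.Product using (Σ; _,_; proj₁; proj₂; _×_)
open import Relation.Nullary using (¬_; Dec; yes; no)
open import Relation.Binary.Bundles using (Setoid)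
import Relation.Binary.Reasoning.Setoid as SetoidReasoning
open import Function using (_∘_; id)
open import Relation.Binary.PropositionalEquality
open import Defs

module _ where

  open import Data.Integer as ℤ using (ℤ; +_; _+_; _*_; _-_; -_; _^_) renaming (∣_∣ to abs)
  import Data.Integer.Properties as ℤₚ
  open import Data.Integer.Tactic.RingSolver using (solve-∀)
  open import Data.Integer.Divisibility.Signed using (_∣_; divides; _∣?_; ∣⇒∣ᵤ; ∣ᵤ⇒∣;
    ∣m∣n⇒∣m+n; ∣m⇒∣-m; ∣m∣n⇒∣m-n; ∣n⇒∣m*n; ∣m⇒∣m*n; ∣m+n∣n⇒∣m)
  open import Data.Integer.DivMod using (a≡a%ℕn+[a/ℕn]*n) renaming (_%ℕ_ to _modℕ_; _/ℕ_ to _divℕ_)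

  -- Coefficient lists, constant term first.
  Poly : Set
  Poly = List ℤ

  -- deriv j F x is the j-th derivative of F at x, by (f + X G)⁽ʲ⁺¹⁾ = (j + 1) G⁽ʲ⁾ + X G⁽ʲ⁺¹⁾.
  deriv : ℕ → Poly → ℤ → ℤ
  deriv j       []       x = + 0
  deriv zero    (f ∷ fs) x = f + x * deriv zero fs x
  deriv (suc j) (f ∷ fs) x = + suc j * deriv j fs x + x * deriv (suc j) fs x

  eval : Poly → ℤ → ℤ
  eval = deriv 0

  coef : ℕ → Poly → ℤ
  coef k       []       = + 0
  coef zero    (f ∷ fs) = f
  coef (suc k) (f ∷ fs) = coef k fs

  coef-beyond : ∀ k F → length F ℕ.≤ k → coef k F ≡ + 0
  coef-beyond k       []       _         = refl
  coef-beyond (suc k) (f ∷ fs) (s≤s le) = coef-beyond k fs le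

  eval-const : ∀ r x → eval (r ∷ []) x ≡ r
  eval-const r x = lem r x
    where lem : ∀ r x → r + x * + 0 ≡ r
          lem = solve-∀

  deriv-suc-const : ∀ j r x → deriv (suc j) (r ∷ []) x ≡ + 0
  deriv-suc-const j r x = lem (+ suc j) x
    where lem : ∀ n x → n * + 0 + x * + 0 ≡ + 0
          lem = solve-∀

  deriv-coef : ∀ k F → deriv k F (+ 0) ≡ + (k !) * coef k F
  deriv-coef k       []       = sym (ℤₚ.*-zeroʳ (+ (k !)))
  deriv-coef zero    (f ∷ fs) = trans (ℤₚ.+-identityʳ f) (sym (ℤₚ.*-identityˡ f))
  deriv-coef (suc j) (f ∷ fs) = begin
    + suc j * deriv j fs (+ 0) + + 0   ≡⟨ ℤₚ.+-identityʳ _ ⟩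
    + suc j * deriv j fs (+ 0)         ≡⟨ cong (+ suc j *_) (deriv-coef j fs) ⟩
    + suc j * (+ (j !) * coef j fs)    ≡⟨ sym (ℤₚ.*-assoc (+ suc j) (+ (j !)) (coef j fs)) ⟩
    + suc j * + (j !) * coef j fs      ≡⟨ cong (_* coef j fs) (sym (ℤₚ.pos-* (suc j) (j !))) ⟩
    + (suc j ! ) * coef j fs           ∎
    where open ≡-Reasoning

  ^-distribʳ-* : ∀ x y n → (x * y) ^ n ≡ x ^ n * y ^ n
  ^-distribʳ-* x y zero    = refl
  ^-distribʳ-* x y (suc n) rewrite ^-distribʳ-* x y n = lem x y (x ^ n) (y ^ n)
    where lem : ∀ x y a b → x * y * (a * b) ≡ x * a * (y * b)
          lem = solve-∀

  square-one-cancelˡ : ∀ ε u → ε * ε ≡ + 1 → ε * (ε * u) ≡ u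
  square-one-cancelˡ ε u ε²≡1 = trans (sym (ℤₚ.*-assoc ε ε u)) (trans (cong (_* u) ε²≡1) (ℤₚ.*-identityˡ u))

  infixl 6 _⊕_
  _⊕_ : Poly → Poly → Poly
  []       ⊕ G        = G
  (f ∷ fs) ⊕ []       = f ∷ fs
  (f ∷ fs) ⊕ (g ∷ gs) = (f + g) ∷ (fs ⊕ gs)

  ⊕-identityʳ : ∀ F → F ⊕ [] ≡ F
  ⊕-identityʳ []      = refl
  ⊕-identityʳ (f ∷ F) = refl

  ⊕-comm : ∀ F G → F ⊕ G ≡ G ⊕ F
  ⊕-comm []       G        = sym (⊕-identityʳ G)
  ⊕-comm (f ∷ F)  []       = refl
  ⊕-comm (f ∷ F)  (g ∷ G)  = cong₂ _∷_ (ℤₚ.+-comm f g) (⊕-comm F G)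

  deriv-⊕ : ∀ j F G x → deriv j (F ⊕ G) x ≡ deriv j F x + deriv j G x
  deriv-⊕ j       []       G        x = sym (ℤₚ.+-identityˡ _)
  deriv-⊕ j       (f ∷ fs) []       x = sym (ℤₚ.+-identityʳ _)
  deriv-⊕ zero    (f ∷ fs) (g ∷ gs) x rewrite deriv-⊕ zero fs gs x =
    lem f g x (eval fs x) (eval gs x)
    where lem : ∀ f g x a b → f + g + x * (a + b) ≡ f + x * a + (g + x * b)
          lem = solve-∀
  deriv-⊕ (suc j) (f ∷ fs) (g ∷ gs) x rewrite deriv-⊕ j fs gs x | deriv-⊕ (suc j) fs gs x =
    lem (+ suc j) x (deriv j fs x) (deriv j gs x) (deriv (suc j) fs x) (deriv (suc j) gs x)
    where lem : ∀ n x a b c d → n * (a + b) + x * (c + d) ≡ n * a + x * c + (n * b + x * d)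
          lem = solve-∀

  coef-⊕ : ∀ k F G → coef k (F ⊕ G) ≡ coef k F + coef k G
  coef-⊕ k       []       G        = sym (ℤₚ.+-identityˡ _)
  coef-⊕ k       (f ∷ fs) []       = sym (ℤₚ.+-identityʳ _)
  coef-⊕ zero    (f ∷ fs) (g ∷ gs) = refl
  coef-⊕ (suc k) (f ∷ fs) (g ∷ gs) = coef-⊕ k fs gs

  length-⊕ : ∀ F G → length (F ⊕ G) ≡ length F ℕ.⊔ length G
  length-⊕ []      G       = refl
  length-⊕ (f ∷ F) []      = refl
  length-⊕ (f ∷ F) (g ∷ G) = cong suc (length-⊕ F G)

  length-⊕-≤ : ∀ F G {n} → length F ℕ.≤ n → length G ℕ.≤ n → length (F ⊕ G) ℕ.≤ n
  length-⊕-≤ F G lF lG = subst (ℕ._≤ _) (sym (length-⊕ F G)) (ℕₚ.⊔-lub lF lG)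

  infixr 7 _⊛_
  _⊛_ : ℤ → Poly → Poly
  k ⊛ []       = []
  k ⊛ (f ∷ fs) = (k * f) ∷ (k ⊛ fs)

  deriv-⊛ : ∀ j k F x → deriv j (k ⊛ F) x ≡ k * deriv j F x
  deriv-⊛ j       k []       x = sym (ℤₚ.*-zeroʳ k)
  deriv-⊛ zero    k (f ∷ fs) x rewrite deriv-⊛ zero k fs x = lem k f x (eval fs x)
    where lem : ∀ k f x a → k * f + x * (k * a) ≡ k * (f + x * a)
          lem = solve-∀
  deriv-⊛ (suc j) k (f ∷ fs) x rewrite deriv-⊛ j k fs x | deriv-⊛ (suc j) k fs x =
    lem k (+ suc j) x (deriv j fs x) (deriv (suc j) fs x)
    where lem : ∀ k n x a b → n * (k * a) + x * (k * b) ≡ k * (n * a + x * b)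
          lem = solve-∀

  coef-⊛ : ∀ k a F → coef k (a ⊛ F) ≡ a * coef k F
  coef-⊛ k       a []       = sym (ℤₚ.*-zeroʳ a)
  coef-⊛ zero    a (f ∷ F)  = refl
  coef-⊛ (suc k) a (f ∷ F)  = coef-⊛ k a F

  length-⊛ : ∀ a F → length (a ⊛ F) ≡ length F
  length-⊛ a []      = refl
  length-⊛ a (f ∷ F) = cong suc (length-⊛ a F)

  linMul : ℤ → Poly → Poly
  linMul a []       = []
  linMul a (g ∷ gs) = (- (a * g)) ∷ ((g ∷ []) ⊕ linMul a gs)

  deriv-linMul : ∀ j a G x →
    deriv j (linMul a G) x ≡ (x - a) * deriv j G x + + j * deriv (ℕ.pred j) G x
  deriv-linMul j a [] x = lem (x - a) (+ j)
    where lem : ∀ u v → + 0 ≡ u * + 0 + v * + 0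
          lem = solve-∀
  deriv-linMul zero a (g ∷ gs) x
    rewrite deriv-⊕ zero (g ∷ []) (linMul a gs) x | eval-const g x | deriv-linMul zero a gs x
    = lem a g x (eval gs x)
    where lem : ∀ a g x e → - (a * g) + x * (g + ((x - a) * e + + 0 * e)) ≡ (x - a) * (g + x * e) + + 0 * (g + x * e)
          lem = solve-∀
  deriv-linMul (suc zero) a (g ∷ gs) x
    rewrite deriv-⊕ zero (g ∷ []) (linMul a gs) x | eval-const g x | deriv-linMul zero a gs x
          | deriv-⊕ 1 (g ∷ []) (linMul a gs) x | deriv-suc-const 0 g x | deriv-linMul 1 a gs x
    = lem a g x (eval gs x) (deriv 1 gs x)
    where lem : ∀ a g x e f → + 1 * (g + ((x - a) * e + + 0 * e)) + x * (+ 0 + ((x - a) * f + + 1 * e))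
                  ≡ (x - a) * (+ 1 * e + x * f) + + 1 * (g + x * e)
          lem = solve-∀
  deriv-linMul (suc (suc k)) a (g ∷ gs) x
    rewrite deriv-⊕ (suc k) (g ∷ []) (linMul a gs) x | deriv-suc-const k g x | deriv-linMul (suc k) a gs x
          | deriv-⊕ (suc (suc k)) (g ∷ []) (linMul a gs) x | deriv-suc-const (suc k) g x
          | deriv-linMul (suc (suc k)) a gs x
    = lem a x (+ suc k) (deriv k gs x) (deriv (suc k) gs x) (deriv (suc (suc k)) gs x)
    where lem : ∀ a x n d₀ d₁ d₂ →
            (+ 1 + n) * (+ 0 + ((x - a) * d₁ + n * d₀)) + x * (+ 0 + ((x - a) * d₂ + (+ 1 + n) * d₁))
              ≡ (x - a) * ((+ 1 + n) * d₁ + x * d₂) + (+ 1 + n) * (n * d₀ + x * d₁)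
          lem = solve-∀

  eval-linMul : ∀ a G x → eval (linMul a G) x ≡ (x - a) * eval G x
  eval-linMul a G x = trans (deriv-linMul 0 a G x) (ℤₚ.+-identityʳ _)

  coef-linMul : ∀ k a G → coef (suc k) (linMul a G) ≡ coef k G - a * coef (suc k) G
  coef-linMul k a [] = lem a
    where lem : ∀ a → + 0 ≡ + 0 - a * + 0
          lem = solve-∀
  coef-linMul zero a (g ∷ [])     = lem g a
    where lem : ∀ g a → g ≡ g - a * + 0
          lem = solve-∀
  coef-linMul zero a (g ∷ h ∷ hs) = refl
  coef-linMul (suc k) a (g ∷ gs) rewrite coef-⊕ (suc k) (g ∷ []) (linMul a gs) | coef-linMul k a gs =
    ℤₚ.+-identityˡ _

  length-linMul : ∀ a g G → length (linMul a (g ∷ G)) ≡ suc (length (g ∷ G))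
  length-linMul a g []      = refl
  length-linMul a g (h ∷ G) =
    cong suc (trans (length-⊕ (g ∷ []) (linMul a (h ∷ G))) (cong (1 ℕ.⊔_) (length-linMul a h G)))

  fall : ℕ → ℕ → ℕ
  fall N       zero    = 1
  fall zero    (suc j) = 0
  fall (suc N) (suc j) = suc N ℕ.* fall N j

  fall-zero : ∀ N j → N ℕ.< j → fall N j ≡ 0
  fall-zero zero    (suc j) _          = refl
  fall-zero (suc N) (suc j) (s≤s N<j) rewrite fall-zero N j N<j = ℕₚ.*-zeroʳ (suc N)

  fall-suc : ∀ N j → fall N (suc j) ≡ (N ℕ.∸ j) ℕ.* fall N j
  fall-suc zero    zero    = refl
  fall-suc zero    (suc j) = refl
  fall-suc (suc N) zero    = refl
  fall-suc (suc N) (suc j) rewrite fall-suc N j =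
    trans (sym (ℕₚ.*-assoc (suc N) (N ℕ.∸ j) (fall N j)))
      (trans (cong (ℕ._* fall N j) (ℕₚ.*-comm (suc N) (N ℕ.∸ j))) (ℕₚ.*-assoc (N ℕ.∸ j) (suc N) (fall N j)))

  fall-suc-pred : ∀ N j → fall N (suc j) ≡ N ℕ.* fall (ℕ.pred N) j
  fall-suc-pred zero    j = refl
  fall-suc-pred (suc N) j = refl

  fall-self : ∀ N → fall N N ≡ N !
  fall-self zero    = refl
  fall-self (suc N) = cong (suc N ℕ.*_) (fall-self N)

  fall-absorb : ∀ N j → (N ℕ.∸ j ℕ.+ suc j) ℕ.* fall N j ≡ suc N ℕ.* fall N j
  fall-absorb N j with ℕₚ.≤-<-connex j N
  ... | inj₁ j≤N = cong (ℕ._* fall N j)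
                     (trans (ℕₚ.+-suc (N ℕ.∸ j) j) (cong suc (ℕₚ.m∸n+n≡m j≤N)))
  ... | inj₂ N<j rewrite fall-zero N j N<j =
    trans (ℕₚ.*-zeroʳ (N ℕ.∸ j ℕ.+ suc j)) (sym (ℕₚ.*-zeroʳ (suc N)))

  -- In the derivative of (X - c)ᴺ⁺¹ the factor X - c is absorbed by one power, or both sides vanish.
  fall-pow-step : ∀ N j y →
    y * (+ fall N (suc j) * y ^ (N ℕ.∸ suc j)) ≡ + (N ℕ.∸ j) * (+ fall N j * y ^ (N ℕ.∸ j))
  fall-pow-step N j y rewrite fall-suc N j | sym (ℕₚ.pred[m∸n]≡m∸[1+n] N j) = step (N ℕ.∸ j) (fall N j)
    where
      step : ∀ k f → y * (+ (k ℕ.* f) * y ^ ℕ.pred k) ≡ + k * (+ f * y ^ k)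
      step zero    f = lem y (y ^ 0) (+ f * y ^ 0)
        where lem : ∀ y a b → y * (+ 0 * a) ≡ + 0 * b
              lem = solve-∀
      step (suc k) f = trans (cong (λ n → y * (n * y ^ k)) (ℤₚ.pos-* (suc k) f)) (lem y (+ suc k) (+ f) (y ^ k))
        where lem : ∀ y n f e → y * (n * f * e) ≡ n * (f * (y * e))
              lem = solve-∀

  rootPoly : List ℤ → Poly
  rootPoly []      = + 1 ∷ []
  rootPoly (c ∷ O) = linMul c (rootPoly O)

  length-rootPoly : ∀ O → length (rootPoly O) ≡ suc (length O)
  length-rootPoly []      = refl
  length-rootPoly (c ∷ O) with rootPoly O | length-rootPoly O
  ... | g ∷ G | eq = trans (length-linMul c g G) (cong suc eq)

  coef-rootPoly-top : ∀ O → coef (length O) (rootPoly O) ≡ + 1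
  coef-rootPoly-top []      = refl
  coef-rootPoly-top (c ∷ O)
    rewrite coef-linMul (length O) c (rootPoly O) | coef-rootPoly-top O
          | coef-beyond (suc (length O)) (rootPoly O) (ℕₚ.≤-reflexive (length-rootPoly O)) = lem c
    where lem : ∀ c → + 1 - c * + 0 ≡ + 1
          lem = solve-∀

  linPow : ℤ → ℕ → Poly
  linPow c N = rootPoly (replicate N c)

  length-linPow : ∀ c N → length (linPow c N) ≡ suc N
  length-linPow c N = trans (length-rootPoly (replicate N c)) (cong suc (Listₚ.length-replicate N))

  coef-linPow-top : ∀ c N → coef N (linPow c N) ≡ + 1
  coef-linPow-top c N =
    subst (λ k → coef k (linPow c N) ≡ + 1) (Listₚ.length-replicate N) (coef-rootPoly-top (replicate N c))

  deriv-linPow : ∀ c N j x → deriv j (linPow c N) x ≡ + fall N j * (x - c) ^ (N ℕ.∸ j)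
  deriv-linPow c zero    zero    x = eval-const (+ 1) x
  deriv-linPow c zero    (suc j) x = trans (deriv-suc-const j (+ 1) x) (sym (ℤₚ.*-zeroˡ ((x - c) ^ (0 ℕ.∸ suc j))))
  deriv-linPow c (suc N) zero    x rewrite eval-linMul c (linPow c N) x | deriv-linPow c N 0 x =
    lem (x - c) ((x - c) ^ N)
    where lem : ∀ y e → y * (+ 1 * e) ≡ + 1 * (y * e)
          lem = solve-∀
  deriv-linPow c (suc N) (suc j) x = begin
    deriv (suc j) (linMul c (linPow c N)) x
      ≡⟨ deriv-linMul (suc j) c (linPow c N) x ⟩
    y * deriv (suc j) (linPow c N) x + + suc j * deriv j (linPow c N) x
      ≡⟨ cong₂ (λ u v → y * u + + suc j * v) (deriv-linPow c N (suc j) x) (deriv-linPow c N j x) ⟩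
    y * (+ fall N (suc j) * y ^ (N ℕ.∸ suc j)) + + suc j * (+ fall N j * y ^ (N ℕ.∸ j))
      ≡⟨ cong (_+ + suc j * (+ fall N j * y ^ (N ℕ.∸ j))) (fall-pow-step N j y) ⟩
    + (N ℕ.∸ j) * (+ fall N j * y ^ (N ℕ.∸ j)) + + suc j * (+ fall N j * y ^ (N ℕ.∸ j))
      ≡⟨ sym (ℤₚ.*-distribʳ-+ (+ fall N j * y ^ (N ℕ.∸ j)) (+ (N ℕ.∸ j)) (+ suc j)) ⟩
    (+ (N ℕ.∸ j) + + suc j) * (+ fall N j * y ^ (N ℕ.∸ j))
      ≡⟨ sym (ℤₚ.*-assoc (+ (N ℕ.∸ j) + + suc j) (+ fall N j) (y ^ (N ℕ.∸ j))) ⟩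
    (+ (N ℕ.∸ j) + + suc j) * + fall N j * y ^ (N ℕ.∸ j)
      ≡⟨ cong (_* y ^ (N ℕ.∸ j)) (sym (trans (ℤₚ.pos-* (N ℕ.∸ j ℕ.+ suc j) (fall N j)) (cong (_* + fall N j) (ℤₚ.pos-+ (N ℕ.∸ j) (suc j))))) ⟩
    + ((N ℕ.∸ j ℕ.+ suc j) ℕ.* fall N j) * y ^ (N ℕ.∸ j)
      ≡⟨ cong (λ n → + n * y ^ (N ℕ.∸ j)) (fall-absorb N j) ⟩
    + fall (suc N) (suc j) * y ^ (N ℕ.∸ j)
      ∎
    where
      open ≡-Reasoning
      y = x - c

  eval-linPow : ∀ c N x → eval (linPow c N) x ≡ (x - c) ^ N
  eval-linPow c N x = trans (deriv-linPow c N 0 x) (ℤₚ.*-identityˡ _)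

  powFrom : ℤ → ℕ → Poly
  powFrom x r = (- + 1) ^ r ⊛ linPow x r

  eval-powFrom : ∀ x r c → eval (powFrom x r) c ≡ (x - c) ^ r
  eval-powFrom x r c = begin
    eval ((- + 1) ^ r ⊛ linPow x r) c     ≡⟨ deriv-⊛ 0 ((- + 1) ^ r) (linPow x r) c ⟩
    (- + 1) ^ r * eval (linPow x r) c     ≡⟨ cong ((- + 1) ^ r *_) (eval-linPow x r c) ⟩
    (- + 1) ^ r * (c - x) ^ r             ≡⟨ sym (^-distribʳ-* (- + 1) (c - x) r) ⟩
    (- + 1 * (c - x)) ^ r                 ≡⟨ cong (_^ r) (lem x c) ⟩
    (x - c) ^ r                           ∎
    where
      open ≡-Reasoning
      lem : ∀ x c → - + 1 * (c - x) ≡ x - c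
      lem = solve-∀

  length-powFrom : ∀ x r → length (powFrom x r) ≡ suc r
  length-powFrom x r = trans (length-⊛ _ (linPow x r)) (length-linPow x r)

  coef-powFrom-top : ∀ x r → coef r (powFrom x r) ≡ (- + 1) ^ r
  coef-powFrom-top x r = trans (coef-⊛ r _ (linPow x r)) (trans (cong ((- + 1) ^ r *_) (coef-linPow-top x r)) (ℤₚ.*-identityʳ _))

  monomial : ℕ → Poly
  monomial zero    = + 1 ∷ []
  monomial (suc n) = + 0 ∷ monomial n

  eval-monomial : ∀ n x → eval (monomial n) x ≡ x ^ n
  eval-monomial zero    x = eval-const (+ 1) x
  eval-monomial (suc n) x rewrite eval-monomial n x = ℤₚ.+-identityˡ _

  length-monomial : ∀ n → length (monomial n) ≡ suc n
  length-monomial zero    = refl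
  length-monomial (suc n) = cong suc (length-monomial n)

  coef-monomial-self : ∀ n → coef n (monomial n) ≡ + 1
  coef-monomial-self zero    = refl
  coef-monomial-self (suc n) = coef-monomial-self n

  coef-monomial-≢ : ∀ k n → k ≢ n → coef k (monomial n) ≡ + 0
  coef-monomial-≢ zero    zero    k≢n = ⊥-elim (k≢n refl)
  coef-monomial-≢ zero    (suc n) k≢n = refl
  coef-monomial-≢ (suc k) zero    k≢n = refl
  coef-monomial-≢ (suc k) (suc n) k≢n = coef-monomial-≢ k n (k≢n ∘ cong suc)

  -- The quotient of F by X - a (synthetic division).
  quot : ℤ → Poly → Poly
  quot a []           = []
  quot a (f ∷ [])     = []
  quot a (f ∷ g ∷ fs) = eval (g ∷ fs) a ∷ quot a (g ∷ fs)

  length-quot : ∀ a f fs → length (quot a (f ∷ fs)) ≡ length fs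
  length-quot a f []       = refl
  length-quot a f (g ∷ fs) = cong suc (length-quot a g fs)

  linMul-quot : ∀ a f fs → linMul a (quot a (f ∷ fs)) ⊕ (eval (f ∷ fs) a ∷ []) ≡ f ∷ fs
  linMul-quot a f []       = cong (_∷ []) (eval-const f a)
  linMul-quot a f (g ∷ gs) = cong₂ _∷_ (lem a f (eval (g ∷ gs) a)) (begin
    (r ∷ []) ⊕ linMul a Q ⊕ []  ≡⟨ ⊕-identityʳ _ ⟩
    (r ∷ []) ⊕ linMul a Q       ≡⟨ ⊕-comm (r ∷ []) (linMul a Q) ⟩
    linMul a Q ⊕ (r ∷ [])       ≡⟨ linMul-quot a g gs ⟩
    g ∷ gs                      ∎)
    where
      open ≡-Reasoning
      r = eval (g ∷ gs) a
      Q = quot a (g ∷ gs)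
      lem : ∀ a f r → - (a * r) + (f + a * r) ≡ f
      lem = solve-∀

  deriv-quot : ∀ j a f fs x →
    deriv j (f ∷ fs) x ≡ (x - a) * deriv j (quot a (f ∷ fs)) x + + j * deriv (ℕ.pred j) (quot a (f ∷ fs)) x
                         + deriv j (eval (f ∷ fs) a ∷ []) x
  deriv-quot j a f fs x = begin
    deriv j (f ∷ fs) x                           ≡⟨ cong (λ F → deriv j F x) (sym (linMul-quot a f fs)) ⟩
    deriv j (linMul a Q ⊕ (r ∷ [])) x             ≡⟨ deriv-⊕ j (linMul a Q) (r ∷ []) x ⟩
    deriv j (linMul a Q) x + deriv j (r ∷ []) x   ≡⟨ cong (_+ deriv j (r ∷ []) x) (deriv-linMul j a Q x) ⟩
    (x - a) * deriv j Q x + + j * deriv (ℕ.pred j) Q x + deriv j (r ∷ []) x ∎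
    where
      open ≡-Reasoning
      Q = quot a (f ∷ fs)
      r = eval (f ∷ fs) a

  ∑ : {A : Set} → List A → (A → ℤ) → ℤ
  ∑ []       f = + 0
  ∑ (t ∷ ts) f = f t + ∑ ts f

  ∑ₚ : {A : Set} → List A → (A → Poly) → Poly
  ∑ₚ []       F = []
  ∑ₚ (t ∷ ts) F = F t ⊕ ∑ₚ ts F

  module _ {A : Set} where

    ∑-cong : ∀ (T : List A) {f g} → (∀ t → f t ≡ g t) → ∑ T f ≡ ∑ T g
    ∑-cong []      eq = refl
    ∑-cong (t ∷ T) eq = cong₂ _+_ (eq t) (∑-cong T eq)

    ∑-cong-All : ∀ {T : List A} {f g} → All (λ t → f t ≡ g t) T → ∑ T f ≡ ∑ T g
    ∑-cong-All []         = refl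
    ∑-cong-All (eq ∷ eqs) = cong₂ _+_ eq (∑-cong-All eqs)

    ∑-zero : ∀ (T : List A) → ∑ T (λ _ → + 0) ≡ + 0
    ∑-zero []      = refl
    ∑-zero (t ∷ T) = trans (ℤₚ.+-identityˡ _) (∑-zero T)

    ∑-+ : ∀ (T : List A) f g → ∑ T (λ t → f t + g t) ≡ ∑ T f + ∑ T g
    ∑-+ []      f g = refl
    ∑-+ (t ∷ T) f g rewrite ∑-+ T f g = lem (f t) (g t) (∑ T f) (∑ T g)
      where lem : ∀ a b c d → a + b + (c + d) ≡ a + c + (b + d)
            lem = solve-∀

    ∑-*ˡ : ∀ (T : List A) a f → ∑ T (λ t → a * f t) ≡ a * ∑ T f
    ∑-*ˡ []      a f = sym (ℤₚ.*-zeroʳ a)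
    ∑-*ˡ (t ∷ T) a f rewrite ∑-*ˡ T a f = sym (ℤₚ.*-distribˡ-+ a (f t) (∑ T f))

    deriv-∑ₚ : ∀ j (T : List A) F x → deriv j (∑ₚ T F) x ≡ ∑ T (λ t → deriv j (F t) x)
    deriv-∑ₚ j []      F x = refl
    deriv-∑ₚ j (t ∷ T) F x = trans (deriv-⊕ j (F t) (∑ₚ T F) x) (cong (λ s → deriv j (F t) x + s) (deriv-∑ₚ j T F x))

    coef-∑ₚ : ∀ k (T : List A) F → coef k (∑ₚ T F) ≡ ∑ T (λ t → coef k (F t))
    coef-∑ₚ k []      F = refl
    coef-∑ₚ k (t ∷ T) F = trans (coef-⊕ k (F t) (∑ₚ T F)) (cong (λ s → coef k (F t) + s) (coef-∑ₚ k T F))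

    length-∑ₚ : ∀ {T : List A} F {n} → All (λ t → length (F t) ℕ.≤ n) T → length (∑ₚ T F) ℕ.≤ n
    length-∑ₚ F [] = z≤n
    length-∑ₚ F (_∷_ {t} {T} l ls) = length-⊕-≤ (F t) (∑ₚ T F) l (length-∑ₚ F ls)


  eval-rootPoly-∈ : ∀ {y} O → y ∈ᴸ O → eval (rootPoly O) y ≡ + 0
  eval-rootPoly-∈ {y} (c ∷ O) y∈cO = trans (eval-linMul c (rootPoly O) y) (zero-factor y∈cO)
    where
      zero-factor : y ∈ᴸ c ∷ O → (y - c) * eval (rootPoly O) y ≡ + 0
      zero-factor (here refl) = trans (cong (_* eval (rootPoly O) y) (ℤₚ.+-inverseʳ y)) (ℤₚ.*-zeroˡ (eval (rootPoly O) y))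
      zero-factor (there y∈O) = trans (cong ((y - c) *_) (eval-rootPoly-∈ O y∈O)) (ℤₚ.*-zeroʳ (y - c))

  record Node : Set where
    constructor node
    field
      point  : ℤ
      sign   : ℤ
      others : List ℤ
  open Node public

  nodes : List ℤ → List (ℤ × ℤ) → List Node
  nodes pre []            = []
  nodes pre ((c , e) ∷ S) = node c e (pre ++ map proj₁ S) ∷ nodes (pre ++ c ∷ []) S

  nodes-point : ∀ pre S → All (λ t → point t ∈ᴸ map proj₁ S) (nodes pre S)
  nodes-point pre []            = []
  nodes-point pre ((c , e) ∷ S) = here refl ∷ All.map there (nodes-point (pre ++ c ∷ []) S)

  nodes-labels : ∀ {Q : ℤ × ℤ → Set} pre S → All Q S → All (λ t → Q (point t , sign t)) (nodes pre S)
  nodes-labels pre []            []       = []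
  nodes-labels pre ((c , e) ∷ S) (q ∷ qs) = q ∷ nodes-labels (pre ++ c ∷ []) S qs

  nodes-others-⊇ : ∀ {y} pre S → y ∈ᴸ pre → All (λ t → y ∈ᴸ others t) (nodes pre S)
  nodes-others-⊇ pre []            y∈pre = []
  nodes-others-⊇ pre ((c , e) ∷ S) y∈pre = ∈-++⁺ˡ y∈pre ∷ nodes-others-⊇ (pre ++ c ∷ []) S (∈-++⁺ˡ y∈pre)

  nodes-others-length : ∀ pre S → All (λ t → suc (length (others t)) ≡ length pre ℕ.+ length S) (nodes pre S)
  nodes-others-length pre []            = []
  nodes-others-length pre ((c , e) ∷ S) =
    len ∷ subst (λ n → All (λ t → suc (length (others t)) ≡ n) (nodes (pre ++ c ∷ []) S)) len′
                (nodes-others-length (pre ++ c ∷ []) S)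
    where
      len : suc (length (pre ++ map proj₁ S)) ≡ length pre ℕ.+ suc (length S)
      len = trans (cong suc (trans (Listₚ.length-++ pre) (cong (length pre ℕ.+_) (Listₚ.length-map proj₁ S))))
                  (sym (ℕₚ.+-suc (length pre) (length S)))
      len′ : length (pre ++ c ∷ []) ℕ.+ length S ≡ length pre ℕ.+ suc (length S)
      len′ = trans (cong (ℕ._+ length S) (trans (Listₚ.length-++ pre) (ℕₚ.+-comm (length pre) 1)))
                   (sym (ℕₚ.+-suc (length pre) (length S)))

  highPart : ℕ → Poly → Poly
  highPart zero    F        = F
  highPart (suc n) []       = []
  highPart (suc n) (f ∷ fs) = + 0 ∷ highPart n fs

  take-⊕-highPart : ∀ n F → take n F ⊕ highPart n F ≡ F
  take-⊕-highPart zero    F        = refl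
  take-⊕-highPart (suc n) []       = refl
  take-⊕-highPart (suc n) (f ∷ fs) = cong₂ _∷_ (ℤₚ.+-identityʳ f) (take-⊕-highPart n fs)

  coef-take : ∀ k n F → k ℕ.< n → coef k (take n F) ≡ coef k F
  coef-take k       (suc n) []       _         = refl
  coef-take zero    (suc n) (f ∷ fs) _         = refl
  coef-take (suc k) (suc n) (f ∷ fs) (s≤s k<n) = coef-take k n fs k<n

  length-take-≤ : ∀ n (F : Poly) → length (take n F) ℕ.≤ n
  length-take-≤ n F = subst (ℕ._≤ n) (sym (Listₚ.length-take n F)) (ℕₚ.m⊓n≤m n (length F))

  module Congruence (p : ℕ) where

    infix 4 _≈_
    record _≈_ (x y : ℤ) : Set where
      constructor mk≈
      field p∣x-y : + p ∣ x - y
    open _≈_ public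

    ∣0 : + p ∣ + 0
    ∣0 = divides (+ 0) refl

    ≈-refl : ∀ {x} → x ≈ x
    ≈-refl {x} = mk≈ (subst (+ p ∣_) (sym (ℤₚ.+-inverseʳ x)) ∣0)

    ≡⇒≈ : ∀ {x y} → x ≡ y → x ≈ y
    ≡⇒≈ refl = ≈-refl

    ≈-sym : ∀ {x y} → x ≈ y → y ≈ x
    ≈-sym {x} {y} (mk≈ e) = mk≈ (subst (+ p ∣_) (lem x y) (∣m⇒∣-m e))
      where lem : ∀ x y → - (x - y) ≡ y - x
            lem = solve-∀

    ≈-trans : ∀ {x y z} → x ≈ y → y ≈ z → x ≈ z
    ≈-trans {x} {y} {z} (mk≈ e) (mk≈ f) = mk≈ (subst (+ p ∣_) (lem x y z) (∣m∣n⇒∣m+n e f))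
      where lem : ∀ x y z → (x - y) + (y - z) ≡ x - z
            lem = solve-∀

    ≈-setoid : Setoid _ _
    ≈-setoid = record { Carrier = ℤ ; _≈_ = _≈_
                      ; isEquivalence = record { refl = ≈-refl ; sym = ≈-sym ; trans = ≈-trans } }

    module ≈-Reasoning = SetoidReasoning ≈-setoid

    +-cong : ∀ {a b c d} → a ≈ b → c ≈ d → a + c ≈ b + d
    +-cong {a} {b} {c} {d} (mk≈ e) (mk≈ f) = mk≈ (subst (+ p ∣_) (lem a b c d) (∣m∣n⇒∣m+n e f))
      where lem : ∀ a b c d → (a - b) + (c - d) ≡ (a + c) - (b + d)
            lem = solve-∀

    ∑-≈ : ∀ {A : Set} (T : List A) {f g} → All (λ t → f t ≈ g t) T → ∑ T f ≈ ∑ T g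
    ∑-≈ []      []         = ≈-refl
    ∑-≈ (t ∷ T) (eq ∷ eqs) = +-cong eq (∑-≈ T eqs)

    *-cong : ∀ {a b c d} → a ≈ b → c ≈ d → a * c ≈ b * d
    *-cong {a} {b} {c} {d} (mk≈ e) (mk≈ f) =
      mk≈ (subst (+ p ∣_) (lem a b c d) (∣m∣n⇒∣m+n (∣m⇒∣m*n c e) (∣n⇒∣m*n b f)))
      where lem : ∀ a b c d → (a - b) * c + b * (c - d) ≡ a * c - b * d
            lem = solve-∀

    ^-cong : ∀ {a b} n → a ≈ b → a ^ n ≈ b ^ n
    ^-cong zero    e = ≈-refl
    ^-cong (suc n) e = *-cong e (^-cong n e)

    ∣⇒≈0 : ∀ {x} → + p ∣ x → x ≈ + 0
    ∣⇒≈0 {x} z = mk≈ (subst (+ p ∣_) (sym (ℤₚ.+-identityʳ x)) z)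

    ≈0⇒∣ : ∀ {x} → x ≈ + 0 → + p ∣ x
    ≈0⇒∣ {x} (mk≈ z) = subst (+ p ∣_) (ℤₚ.+-identityʳ x) z

    ∣-resp-≈ : ∀ {x y} → x ≈ y → + p ∣ x → + p ∣ y
    ∣-resp-≈ {x} {y} (mk≈ e) z = subst (+ p ∣_) (lem x y) (∣m∣n⇒∣m-n z e)
      where lem : ∀ x y → x - (x - y) ≡ y
            lem = solve-∀

    ∣-swap : ∀ {a b} → + p ∣ a - b → + p ∣ b - a
    ∣-swap {a} {b} e = p∣x-y (≈-sym {a} {b} (mk≈ e))

    Apart : ℤ → ℤ → Set
    Apart a b = ¬ + p ∣ a - b

    apart-sym : ∀ {a b} → Apart a b → Apart b a
    apart-sym {a} {b} ab ba = ab (∣-swap {b} {a} ba)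

    Distinct : List ℤ → Set
    Distinct = AllPairs Apart

    VanishesToOrder : ℕ → Poly → ℤ → Set
    VanishesToOrder m F a = ∀ j → j ℕ.< m → + p ∣ deriv j F a

    ZeroPoly : Poly → Set
    ZeroPoly = All (+ p ∣_)

    zeroPoly-deriv : ∀ j F x → ZeroPoly F → + p ∣ deriv j F x
    zeroPoly-deriv j       []       x _          = ∣0
    zeroPoly-deriv zero    (f ∷ fs) x (zf ∷ zs) = ∣m∣n⇒∣m+n zf (∣n⇒∣m*n x (zeroPoly-deriv zero fs x zs))
    zeroPoly-deriv (suc j) (f ∷ fs) x (zf ∷ zs) =
      ∣m∣n⇒∣m+n (∣n⇒∣m*n (+ suc j) (zeroPoly-deriv j fs x zs)) (∣n⇒∣m*n x (zeroPoly-deriv (suc j) fs x zs))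

    zeroPoly-coef : ∀ k F → ZeroPoly F → + p ∣ coef k F
    zeroPoly-coef k       []       _        = ∣0
    zeroPoly-coef zero    (f ∷ fs) (z ∷ _)  = z
    zeroPoly-coef (suc k) (f ∷ fs) (_ ∷ zs) = zeroPoly-coef k fs zs

    zeroPoly-highPart : ∀ n F → (∀ k → n ℕ.≤ k → + p ∣ coef k F) → ZeroPoly (highPart n F)
    zeroPoly-highPart zero    []       h = []
    zeroPoly-highPart (suc n) []       h = []
    zeroPoly-highPart zero    (f ∷ fs) h = h zero z≤n ∷ zeroPoly-highPart zero fs (λ k _ → h (suc k) z≤n)
    zeroPoly-highPart (suc n) (f ∷ fs) h = ∣0 ∷ zeroPoly-highPart n fs (λ k n≤k → h (suc k) (s≤s n≤k))

    zeroPoly-⊕ : ∀ F G → ZeroPoly F → ZeroPoly G → ZeroPoly (F ⊕ G)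
    zeroPoly-⊕ []       G        _         zG        = zG
    zeroPoly-⊕ (f ∷ fs) []       zF        _         = zF
    zeroPoly-⊕ (f ∷ fs) (g ∷ gs) (zf ∷ zF) (zg ∷ zG) = ∣m∣n⇒∣m+n zf zg ∷ zeroPoly-⊕ fs gs zF zG

    zeroPoly-linMul : ∀ a G → ZeroPoly G → ZeroPoly (linMul a G)
    zeroPoly-linMul a []       _         = []
    zeroPoly-linMul a (g ∷ gs) (zg ∷ zG) =
      ∣m⇒∣-m (∣n⇒∣m*n a zg) ∷ zeroPoly-⊕ (g ∷ []) (linMul a gs) (zg ∷ []) (zeroPoly-linMul a gs zG)

    zeroPoly-quot : ∀ a f fs → ZeroPoly (quot a (f ∷ fs)) → + p ∣ eval (f ∷ fs) a → ZeroPoly (f ∷ fs)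
    zeroPoly-quot a f fs zQ zr = subst ZeroPoly (linMul-quot a f fs)
      (zeroPoly-⊕ (linMul a (quot a (f ∷ fs))) _ (zeroPoly-linMul a _ zQ) (zr ∷ []))

  module PrimeModulus (p : ℕ) (p-prime : Prime p) where

    open Congruence p

    instance
      p-nonZero : ℕ.NonZero p
      p-nonZero = prime⇒nonZero p-prime

    1<p : 1 ℕ.< p
    1<p = ℕ.nonTrivial⇒n>1 p {{prime⇒nonTrivial p-prime}}

    euclid : ∀ x y → + p ∣ x * y → + p ∣ x ⊎ + p ∣ y
    euclid x y p∣xy with euclidsLemma (abs x) (abs y) p-prime (subst (p ℕᵈ.∣_) (ℤₚ.abs-* x y) (∣⇒∣ᵤ p∣xy))
    ... | inj₁ p∣x = inj₁ (∣ᵤ⇒∣ p∣x)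
    ... | inj₂ p∣y = inj₂ (∣ᵤ⇒∣ p∣y)

    ∤-* : ∀ {x y} → ¬ + p ∣ x → ¬ + p ∣ y → ¬ + p ∣ x * y
    ∤-* {x} {y} p∤x p∤y p∣xy with euclid x y p∣xy
    ... | inj₁ p∣x = p∤x p∣x
    ... | inj₂ p∣y = p∤y p∣y

    ∣-cancelˡ : ∀ {c x} → ¬ + p ∣ c → + p ∣ c * x → + p ∣ x
    ∣-cancelˡ {c} {x} p∤c p∣cx with euclid c x p∣cx
    ... | inj₁ p∣c = ⊥-elim (p∤c p∣c)
    ... | inj₂ p∣x = p∣x

    ∣-cancelʳ : ∀ {c x} → ¬ + p ∣ c → + p ∣ x * c → + p ∣ x
    ∣-cancelʳ {c} {x} p∤c p∣xc = ∣-cancelˡ p∤c (subst (+ p ∣_) (ℤₚ.*-comm x c) p∣xc)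

    ≈-cancelˡ : ∀ {c x y} → ¬ + p ∣ c → c * x ≈ c * y → x ≈ y
    ≈-cancelˡ {c} {x} {y} p∤c (mk≈ e) = mk≈ (∣-cancelˡ p∤c (subst (+ p ∣_) (lem c x y) e))
      where lem : ∀ c x y → c * x - c * y ≡ c * (x - y)
            lem = solve-∀

    ∤-pos : ∀ {n} → 0 ℕ.< n → n ℕ.< p → ¬ + p ∣ + n
    ∤-pos {n} 0<n n<p p∣n = ℕₚ.<⇒≱ n<p (ℕᵈ.∣⇒≤ {{ℕ.>-nonZero 0<n}} (∣⇒∣ᵤ p∣n))

    ∤1 : ¬ + p ∣ + 1
    ∤1 = ∤-pos (s≤s z≤n) 1<p

    ∤-fall : ∀ N k → k ℕ.≤ N → N ℕ.< p → ¬ + p ∣ + fall N k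
    ∤-fall N       zero    _        _   = ∤1
    ∤-fall (suc N) (suc k) (s≤s k≤N) N<p p∣f =
      ∤-* (∤-pos (s≤s z≤n) N<p) (∤-fall N k k≤N (ℕₚ.<-trans (ℕₚ.n<1+n N) N<p))
          (subst (+ p ∣_) (ℤₚ.pos-* (suc N) (fall N k)) p∣f)

    ∤-! : ∀ k → k ℕ.< p → ¬ + p ∣ + (k !)
    ∤-! k k<p = subst (λ n → ¬ + p ∣ + n) (fall-self k) (∤-fall k k ℕₚ.≤-refl k<p)

    apart-< : ∀ {a b} → a ℕ.< b → b ℕ.< p → Apart (+ b) (+ a)
    apart-< {a} {b} a<b b<p p∣b-a = ∤-pos (ℕₚ.m<n⇒0<n∸m a<b) (ℕₚ.≤-<-trans (ℕₚ.m∸n≤m b a) b<p)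
      (subst (+ p ∣_) (trans (ℤₚ.m-n≡m⊖n b a) (ℤₚ.⊖-≥ (ℕₚ.<⇒≤ a<b))) p∣b-a)

    apart-ℕ : ∀ {a b} → a ≢ b → a ℕ.< p → b ℕ.< p → Apart (+ a) (+ b)
    apart-ℕ {a} {b} a≢b a<p b<p with ℕₚ.<-cmp a b
    ... | tri< a<b _ _ = apart-sym {+ b} {+ a} (apart-< a<b b<p)
    ... | tri≈ _ a≡b _ = ⊥-elim (a≢b a≡b)
    ... | tri> _ _ b<a = apart-< b<a a<p

    quot-deriv-step : ∀ j a f fs x → + p ∣ eval (f ∷ fs) a → + p ∣ deriv j (f ∷ fs) x →
      + p ∣ (x - a) * deriv j (quot a (f ∷ fs)) x + + j * deriv (ℕ.pred j) (quot a (f ∷ fs)) x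
    quot-deriv-step j a f fs x p∣r p∣F =
      ∣m+n∣n⇒∣m (subst (+ p ∣_) (deriv-quot j a f fs x) p∣F) (zeroPoly-deriv j _ x (p∣r ∷ []))

    vanishes-quot-apart : ∀ {a b m} f fs → Apart b a → + p ∣ eval (f ∷ fs) a →
      VanishesToOrder m (f ∷ fs) b → VanishesToOrder m (quot a (f ∷ fs)) b
    vanishes-quot-apart {a} {b} f fs b≉a p∣r van zero    0<m =
      ∣-cancelˡ b≉a (∣m+n∣n⇒∣m (quot-deriv-step 0 a f fs b p∣r (van 0 0<m))
                               (subst (+ p ∣_) (sym (ℤₚ.*-zeroˡ (eval (quot a (f ∷ fs)) b))) ∣0))
    vanishes-quot-apart {a} {b} f fs b≉a p∣r van (suc j) j<m =
      ∣-cancelˡ b≉a (∣m+n∣n⇒∣m (quot-deriv-step (suc j) a f fs b p∣r (van (suc j) j<m))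
                               (∣n⇒∣m*n (+ suc j) (vanishes-quot-apart f fs b≉a p∣r van j (ℕₚ.<-trans (ℕₚ.n<1+n j) j<m))))

    vanishes-quot-self : ∀ {a m} f fs → suc m ℕ.≤ p → VanishesToOrder (suc m) (f ∷ fs) a →
      VanishesToOrder m (quot a (f ∷ fs)) a
    vanishes-quot-self {a} f fs m<p van j j<m =
      ∣-cancelˡ (∤-pos (s≤s z≤n) (ℕₚ.<-≤-trans (s≤s j<m) m<p))
        (subst (+ p ∣_) (lem a (deriv (suc j) Q a) (+ suc j * deriv j Q a))
          (quot-deriv-step (suc j) a f fs a (van 0 (s≤s z≤n)) (van (suc j) (s≤s j<m))))
      where
        Q = quot a (f ∷ fs)
        lem : ∀ a u v → (a - a) * u + v ≡ v
        lem = solve-∀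

    -- Multiplicities are capped at p: only then is a root of order m detected by F⁽ʲ⁾, j < m.
    rootMultiplicities≤degree : ∀ M F → length F ℕ.≤ suc M → ¬ ZeroPoly F →
      ∀ pts → AllPairs (λ u v → Apart (proj₁ u) (proj₁ v)) pts → All (λ u → proj₂ u ℕ.≤ p) pts →
      All (λ u → VanishesToOrder (proj₂ u) F (proj₁ u)) pts → sum (map proj₂ pts) ℕ.≤ M
    rootMultiplicities≤degree M F lenF F≢0 [] _ _ _ = z≤n
    rootMultiplicities≤degree M F lenF F≢0 ((a , zero) ∷ ps) (_ ∷ dps) (_ ∷ bps) (_ ∷ vps) =
      rootMultiplicities≤degree M F lenF F≢0 ps dps bps vps
    rootMultiplicities≤degree M [] lenF F≢0 ((a , suc m) ∷ ps) _ _ _ = ⊥-elim (F≢0 [])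
    rootMultiplicities≤degree M (f ∷ []) lenF F≢0 ((a , suc m) ∷ ps) _ _ (va ∷ _) =
      ⊥-elim (F≢0 (subst (+ p ∣_) (eval-const f a) (va 0 (s≤s z≤n)) ∷ []))
    rootMultiplicities≤degree zero (f ∷ g ∷ gs) (s≤s ()) F≢0 ((a , suc m) ∷ ps) _ _ _
    rootMultiplicities≤degree (suc M) (f ∷ g ∷ gs) (s≤s lenF) F≢0 ((a , suc m) ∷ ps) (da ∷ dps) (ba ∷ bps) (va ∷ vps) =
      s≤s (rootMultiplicities≤degree M (quot a F) (subst (ℕ._≤ suc M) (sym (length-quot a f (g ∷ gs))) lenF)
            (λ zQ → F≢0 (zeroPoly-quot a f (g ∷ gs) zQ p∣Fa))
            ((a , m) ∷ ps) (da ∷ dps) (ℕₚ.<⇒≤ ba ∷ bps)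
            (vanishes-quot-self f (g ∷ gs) ba va ∷ vanishes-elsewhere ps da vps))
      where
        F = f ∷ g ∷ gs
        p∣Fa : + p ∣ eval F a
        p∣Fa = va 0 (s≤s z≤n)
        vanishes-elsewhere : ∀ qs → All (λ u → Apart a (proj₁ u)) qs → All (λ u → VanishesToOrder (proj₂ u) F (proj₁ u)) qs →
          All (λ u → VanishesToOrder (proj₂ u) (quot a F) (proj₁ u)) qs
        vanishes-elsewhere []       _        _          = []
        vanishes-elsewhere (q ∷ qs) (d ∷ ds) (v ∷ vs) =
          vanishes-quot-apart f (g ∷ gs) (apart-sym {a} {proj₁ q} d) p∣Fa v ∷ vanishes-elsewhere qs ds vs

    rootMultiplicities≤ : ∀ F M k → k ℕ.≤ M → ¬ + p ∣ coef k F → (∀ i → M ℕ.< i → + p ∣ coef i F) →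
      ∀ pts → AllPairs (λ u v → Apart (proj₁ u) (proj₁ v)) pts → All (λ u → proj₂ u ℕ.≤ p) pts →
      All (λ u → VanishesToOrder (proj₂ u) F (proj₁ u)) pts → sum (map proj₂ pts) ℕ.≤ M
    rootMultiplicities≤ F M k k≤M p∤Fₖ high pts dps bps vps =
      rootMultiplicities≤degree M low (length-take-≤ (suc M) F)
        (λ zL → p∤Fₖ (subst (+ p ∣_) (coef-take k (suc M) F (s≤s k≤M)) (zeroPoly-coef k low zL)))
        pts dps bps (All.map vanishes-low vps)
      where
        low = take (suc M) F
        vanishes-low : ∀ {u} → VanishesToOrder (proj₂ u) F (proj₁ u) → VanishesToOrder (proj₂ u) low (proj₁ u)
        vanishes-low {a , m} van j j<m = ∣m+n∣n⇒∣m
          (subst (+ p ∣_) (trans (cong (λ G → deriv j G a) (sym (take-⊕-highPart (suc M) F)))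
                                 (deriv-⊕ j low (highPart (suc M) F) a)) (van j j<m))
          (zeroPoly-deriv j _ a (zeroPoly-highPart (suc M) F high))

    simpleRoots : List ℤ → List (ℤ × ℕ)
    simpleRoots = map (_, 1)

    sum-simpleRoots : ∀ L → sum (map proj₂ (simpleRoots L)) ≡ length L
    sum-simpleRoots []      = refl
    sum-simpleRoots (c ∷ L) = cong suc (sum-simpleRoots L)

    zeroPoly-of-roots : ∀ D L → Distinct L → All (λ y → + p ∣ eval D y) L → length D ℕ.≤ length L → ZeroPoly D
    zeroPoly-of-roots []       L _    _   _    = []
    zeroPoly-of-roots (d ∷ ds) L dist van lenD with All.all? (+ p ∣?_) (d ∷ ds)
    ... | yes zD = zD
    ... | no  D≢0 = ⊥-elim (ℕₚ.<-irrefl refl (ℕₚ.≤-trans (s≤s count) lenD))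
      where
        count : length L ℕ.≤ length ds
        count = subst (ℕ._≤ length ds) (sum-simpleRoots L)
          (rootMultiplicities≤degree (length ds) (d ∷ ds) ℕₚ.≤-refl D≢0 (simpleRoots L)
            (AllPairsₚ.map⁺ dist) (Allₚ.map⁺ (All.tabulate (λ _ → ℕₚ.<⇒≤ 1<p)))
            (Allₚ.map⁺ (All.map (λ { p∣D zero _ → p∣D ; p∣D (suc j) (s≤s ()) }) van)))

    coefs-≈⇒eval-≈ : ∀ F G x → (∀ k → coef k F ≈ coef k G) → eval F x ≈ eval G x
    coefs-≈⇒eval-≈ []       []       x c = ≈-refl
    coefs-≈⇒eval-≈ []       (g ∷ gs) x c = ≈-trans (≡⇒≈ (sym (ℤₚ.+-identityʳ (+ 0))))
      (+-cong (c zero) (≈-trans (≡⇒≈ (sym (ℤₚ.*-zeroʳ x))) (*-cong (≈-refl {x}) (coefs-≈⇒eval-≈ [] gs x (c ∘ suc)))))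
    coefs-≈⇒eval-≈ (f ∷ fs) []       x c = ≈-trans (+-cong (c zero) (*-cong (≈-refl {x}) (coefs-≈⇒eval-≈ fs [] x (c ∘ suc))))
      (≡⇒≈ (trans (cong (_+_ (+ 0)) (ℤₚ.*-zeroʳ x)) (ℤₚ.+-identityʳ (+ 0))))
    coefs-≈⇒eval-≈ (f ∷ fs) (g ∷ gs) x c = +-cong (c zero) (*-cong (≈-refl {x}) (coefs-≈⇒eval-≈ fs gs x (c ∘ suc)))

    coef-binomial : ∀ k → + (k !) * coef k (linPow (- + 1) p) ≡ + fall p k
    coef-binomial k = begin
      + (k !) * coef k (linPow (- + 1) p)     ≡⟨ sym (deriv-coef k (linPow (- + 1) p)) ⟩
      deriv k (linPow (- + 1) p) (+ 0)        ≡⟨ deriv-linPow (- + 1) p k (+ 0) ⟩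
      + fall p k * (+ 1) ^ (p ℕ.∸ k)          ≡⟨ cong (_*_ (+ fall p k)) (ℤₚ.^-zeroˡ (p ℕ.∸ k)) ⟩
      + fall p k * + 1                        ≡⟨ ℤₚ.*-identityʳ _ ⟩
      + fall p k                              ∎
      where open ≡-Reasoning

    binomial-coefs-≈ : ∀ k → coef k (linPow (- + 1) p) ≈ coef k ((+ 1 ∷ []) ⊕ monomial p)
    binomial-coefs-≈ zero = ≡⇒≈ (begin
      coef 0 (linPow (- + 1) p)                      ≡⟨ sym (ℤₚ.*-identityˡ _) ⟩
      + 1 * coef 0 (linPow (- + 1) p)                ≡⟨ coef-binomial 0 ⟩
      + 1                                            ≡⟨ sym (cong (_+_ (+ 1)) (coef-monomial-≢ 0 p (ℕₚ.<⇒≢ (ℕₚ.<-trans (s≤s z≤n) 1<p)))) ⟩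
      + 1 + coef 0 (monomial p)                      ≡⟨ sym (coef-⊕ 0 (+ 1 ∷ []) (monomial p)) ⟩
      coef 0 ((+ 1 ∷ []) ⊕ monomial p)               ∎)
      where open ≡-Reasoning
    binomial-coefs-≈ (suc i)
      rewrite coef-⊕ (suc i) (+ 1 ∷ []) (monomial p) | ℤₚ.+-identityˡ (coef (suc i) (monomial p))
      with ℕₚ.<-cmp (suc i) p
    ... | tri< i<p _ _ rewrite coef-monomial-≢ (suc i) p (ℕₚ.<⇒≢ i<p) =
      ∣⇒≈0 (∣-cancelˡ (∤-! (suc i) i<p) (subst (+ p ∣_) (sym (coef-binomial (suc i))) p∣fall))
      where
        p∣fall : + p ∣ + fall p (suc i)
        p∣fall = divides (+ fall (ℕ.pred p) i)
          (trans (cong +_ (trans (fall-suc-pred p i) (ℕₚ.*-comm p (fall (ℕ.pred p) i)))) (ℤₚ.pos-* (fall (ℕ.pred p) i) p))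
    ... | tri≈ _ refl _ = ≡⇒≈ (trans (coef-linPow-top (- + 1) p) (sym (coef-monomial-self p)))
    ... | tri> _ _ p<i rewrite coef-monomial-≢ (suc i) p (ℕₚ.>⇒≢ p<i)
      | coef-beyond (suc i) (linPow (- + 1) p) (ℕₚ.≤-trans (ℕₚ.≤-reflexive (length-linPow (- + 1) p)) p<i) = ≈-refl

    freshman : ∀ a → (a + + 1) ^ p ≈ a ^ p + + 1
    freshman a = begin
      (a + + 1) ^ p                       ≡⟨ cong (_^ p) (lem a) ⟨
      (a - - + 1) ^ p                     ≡⟨ eval-linPow (- + 1) p a ⟨
      eval (linPow (- + 1) p) a           ≈⟨ coefs-≈⇒eval-≈ (linPow (- + 1) p) ((+ 1 ∷ []) ⊕ monomial p) a binomial-coefs-≈ ⟩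
      eval ((+ 1 ∷ []) ⊕ monomial p) a    ≡⟨ deriv-⊕ 0 (+ 1 ∷ []) (monomial p) a ⟩
      eval (+ 1 ∷ []) a + eval (monomial p) a ≡⟨ cong₂ _+_ (eval-const (+ 1) a) (eval-monomial p a) ⟩
      + 1 + a ^ p                         ≡⟨ ℤₚ.+-comm (+ 1) (a ^ p) ⟩
      a ^ p + + 1                         ∎
      where
        open ≈-Reasoning
        lem : ∀ a → a - - + 1 ≡ a + + 1
        lem = solve-∀

    fermat-ℕ : ∀ n → (+ n) ^ p ≈ + n
    fermat-ℕ zero    = ≡⇒≈ (trans (cong (_^_ (+ 0)) (sym (ℕₚ.suc-pred p))) (ℤₚ.*-zeroˡ ((+ 0) ^ ℕ.pred p)))
    fermat-ℕ (suc n) = begin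
      (+ suc n) ^ p      ≡⟨ cong (_^ p) (suc≡+1 n) ⟩
      (+ n + + 1) ^ p    ≈⟨ freshman (+ n) ⟩
      (+ n) ^ p + + 1    ≈⟨ +-cong (fermat-ℕ n) ≈-refl ⟩
      + n + + 1          ≡⟨ sym (suc≡+1 n) ⟩
      + suc n            ∎
      where
        open ≈-Reasoning
        suc≡+1 : ∀ n → + suc n ≡ + n + + 1
        suc≡+1 n = trans (cong +_ (ℕₚ.+-comm 1 n)) (ℤₚ.pos-+ n 1)

    ≈-modℕ : ∀ x → x ≈ + (x modℕ p)
    ≈-modℕ x = mk≈ (divides (x divℕ p) (begin
      x - + (x modℕ p)                                      ≡⟨ cong (_- + (x modℕ p)) (a≡a%ℕn+[a/ℕn]*n x p) ⟩
      + (x modℕ p) + x divℕ p * + p - + (x modℕ p)          ≡⟨ lem (+ (x modℕ p)) (x divℕ p * + p) ⟩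
      x divℕ p * + p                                        ∎))
      where
        open ≡-Reasoning
        lem : ∀ r s → r + s - r ≡ s
        lem = solve-∀

    fermat : ∀ x → x ^ p ≈ x
    fermat x = begin
      x ^ p                  ≈⟨ ^-cong p (≈-modℕ x) ⟩
      (+ (x modℕ p)) ^ p     ≈⟨ fermat-ℕ (x modℕ p) ⟩
      + (x modℕ p)           ≈⟨ ≈-sym (≈-modℕ x) ⟩
      x                      ∎
      where open ≈-Reasoning

    fermat-unit : ∀ x → ¬ + p ∣ x → x ^ ℕ.pred p ≈ + 1
    fermat-unit x p∤x = ≈-cancelˡ p∤x (begin
      x * x ^ ℕ.pred p     ≡⟨ cong (x ^_) (ℕₚ.suc-pred p ) ⟩
      x ^ p                ≈⟨ fermat x ⟩
      x                    ≡⟨ sym (ℤₚ.*-identityʳ x) ⟩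
      x * + 1              ∎)
      where open ≈-Reasoning

    inverse : ℤ → ℤ
    inverse x = x ^ ℕ.pred (ℕ.pred p)

    inverse-inverseʳ : ∀ x → ¬ + p ∣ x → x * inverse x ≈ + 1
    inverse-inverseʳ x p∤x = ≈-trans (≡⇒≈ (cong (x ^_) (ℕₚ.suc-pred (ℕ.pred p) {{pred-nonZero}}))) (fermat-unit x p∤x)
      where
        pred-nonZero : ℕ.NonZero (ℕ.pred p)
        pred-nonZero = ℕ.>-nonZero (ℕₚ.pred-mono-≤ 1<p)

    invProd : List ℤ → ℤ → ℤ
    invProd []      y = + 1
    invProd (c ∷ O) y = inverse (y - c) * invProd O y

    invProd-inverseˡ : ∀ O y → All (Apart y) O → invProd O y * eval (rootPoly O) y ≈ + 1
    invProd-inverseˡ []      y []           = ≡⇒≈ (cong (+ 1 *_) (eval-const (+ 1) y))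
    invProd-inverseˡ (c ∷ O) y (y≉c ∷ y≉O) = begin
      inverse (y - c) * invProd O y * eval (rootPoly (c ∷ O)) y    ≡⟨ cong (inverse (y - c) * invProd O y *_) (eval-linMul c (rootPoly O) y) ⟩
      inverse (y - c) * invProd O y * ((y - c) * eval (rootPoly O) y) ≡⟨ lem (inverse (y - c)) (invProd O y) (y - c) (eval (rootPoly O) y) ⟩
      ((y - c) * inverse (y - c)) * (invProd O y * eval (rootPoly O) y) ≈⟨ *-cong (inverse-inverseʳ (y - c) y≉c) (invProd-inverseˡ O y y≉O) ⟩
      + 1                                                          ∎
      where
        open ≈-Reasoning
        lem : ∀ i a b q → i * a * (b * q) ≡ (b * i) * (a * q)
        lem = solve-∀

    eval-rootPoly-apart : ∀ O y → All (Apart y) O → ¬ + p ∣ eval (rootPoly O) y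
    eval-rootPoly-apart []      y []           = subst (λ z → ¬ + p ∣ z) (sym (eval-const (+ 1) y)) ∤1
    eval-rootPoly-apart (c ∷ O) y (y≉c ∷ y≉O) =
      subst (λ z → ¬ + p ∣ z) (sym (eval-linMul c (rootPoly O) y)) (∤-* y≉c (eval-rootPoly-apart O y y≉O))

    apart-from-rest : ∀ pre c rest → Distinct (pre ++ c ∷ rest) → All (Apart c) (pre ++ rest)
    apart-from-rest []        c rest (c≉rest ∷ _)  = c≉rest
    apart-from-rest (x ∷ pre) c rest (x≉ ∷ dist) =
      apart-sym {x} {c} (All.lookup x≉ (∈-++⁺ʳ pre (here refl))) ∷ apart-from-rest pre c rest dist

    weight : Node → ℤ
    weight t = invProd (others t) (point t)

    interpolate : ∀ pre S y (K : ℤ → ℤ) → Distinct (pre ++ map proj₁ S) → y ∈ᴸ map proj₁ S →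
      ∑ (nodes pre S) (λ t → K (point t) * weight t * eval (rootPoly (others t)) y) ≈ K y
    interpolate pre ((c , e) ∷ S) y K dist (here refl) = begin
      K y * invProd O y * eval (rootPoly O) y + ∑ (nodes (pre ++ y ∷ []) S) term
        ≡⟨ cong₂ _+_ (ℤₚ.*-assoc (K y) (invProd O y) (eval (rootPoly O) y)) rest-vanishes ⟩
      K y * (invProd O y * eval (rootPoly O) y) + + 0
        ≈⟨ +-cong (*-cong (≈-refl {K y}) (invProd-inverseˡ O y (apart-from-rest pre y (map proj₁ S) dist))) ≈-refl ⟩
      K y * + 1 + + 0
        ≡⟨ lem (K y) ⟩
      K y ∎
      where
        open ≈-Reasoning
        O = pre ++ map proj₁ S
        term : Node → ℤ
        term t = K (point t) * weight t * eval (rootPoly (others t)) y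
        rest-vanishes : ∑ (nodes (pre ++ y ∷ []) S) term ≡ + 0
        rest-vanishes = trans (∑-cong-All {f = term} {g = λ _ → + 0}
                                (All.map (λ {t} → term-vanishes {t}) (nodes-others-⊇ (pre ++ y ∷ []) S (∈-++⁺ʳ pre (here refl)))))
                              (∑-zero (nodes (pre ++ y ∷ []) S))
          where
            term-vanishes : ∀ {t} → y ∈ᴸ others t → term t ≡ + 0
            term-vanishes {t} y∈O = trans (cong (K (point t) * weight t *_) (eval-rootPoly-∈ (others t) y∈O))
                                          (ℤₚ.*-zeroʳ (K (point t) * weight t))
        lem : ∀ k → k * + 1 + + 0 ≡ k
        lem = solve-∀
    interpolate pre ((c , e) ∷ S) y K dist (there y∈S) = begin
      K c * invProd O c * eval (rootPoly O) y + ∑ (nodes (pre ++ c ∷ []) S) term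
        ≡⟨ cong (_+ ∑ (nodes (pre ++ c ∷ []) S) term) first-vanishes ⟩
      + 0 + ∑ (nodes (pre ++ c ∷ []) S) term
        ≈⟨ +-cong (≈-refl {+ 0}) (interpolate (pre ++ c ∷ []) S y K dist′ y∈S) ⟩
      + 0 + K y
        ≡⟨ ℤₚ.+-identityˡ (K y) ⟩
      K y ∎
      where
        open ≈-Reasoning
        O = pre ++ map proj₁ S
        term : Node → ℤ
        term t = K (point t) * weight t * eval (rootPoly (others t)) y
        first-vanishes : K c * invProd O c * eval (rootPoly O) y ≡ + 0
        first-vanishes = trans (cong (K c * invProd O c *_) (eval-rootPoly-∈ O (∈-++⁺ʳ pre y∈S))) (ℤₚ.*-zeroʳ (K c * invProd O c))
        dist′ : Distinct ((pre ++ c ∷ []) ++ map proj₁ S)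
        dist′ = subst Distinct (sym (Listₚ.++-assoc pre (c ∷ []) (map proj₁ S))) dist

    interpolant : List Node → Poly → Poly
    interpolant T g = ∑ₚ T (λ t → (eval g (point t) * weight t) ⊛ rootPoly (others t))

    eval-interpolant : ∀ S g {y} → Distinct (map proj₁ S) → y ∈ᴸ map proj₁ S →
      eval (interpolant (nodes [] S) g) y ≈ eval g y
    eval-interpolant S g {y} dist y∈S = ≈-trans
      (≡⇒≈ (trans (deriv-∑ₚ 0 (nodes [] S) _ y)
                  (∑-cong (nodes [] S) (λ t → deriv-⊛ 0 (eval g (point t) * weight t) (rootPoly (others t)) y))))
      (interpolate [] S y (eval g) dist y∈S)

    length-interpolant : ∀ S g → length (interpolant (nodes [] S) g) ℕ.≤ length S
    length-interpolant S g = length-∑ₚ _ (All.map (λ {t} len → ℕₚ.≤-reflexive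
      (trans (length-⊛ _ (rootPoly (others t))) (trans (length-rootPoly (others t)) len))) (nodes-others-length [] S))

    coef-interpolant-top : ∀ S n g → length S ≡ suc n →
      coef n (interpolant (nodes [] S) g) ≡ ∑ (nodes [] S) (λ t → weight t * eval g (point t))
    coef-interpolant-top S n g lenS = trans (coef-∑ₚ n (nodes [] S) _)
      (∑-cong-All (All.map (λ {t} len → top t (ℕₚ.suc-injective (trans len lenS))) (nodes-others-length [] S)))
      where
        top : ∀ t → length (others t) ≡ n →
          coef n ((eval g (point t) * weight t) ⊛ rootPoly (others t)) ≡ weight t * eval g (point t)
        top t refl = trans (coef-⊛ (length (others t)) _ (rootPoly (others t)))
          (trans (cong (eval g (point t) * weight t *_) (coef-rootPoly-top (others t)))
                 (trans (ℤₚ.*-identityʳ _) (ℤₚ.*-comm (eval g (point t)) (weight t))))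

    lagrange-top : ∀ S n → length S ≡ suc n → Distinct (map proj₁ S) → ∀ g → length g ℕ.≤ suc n →
      ∑ (nodes [] S) (λ t → weight t * eval g (point t)) ≈ coef n g
    lagrange-top S n lenS dist g len-g = mk≈ (subst (+ p ∣_) coef-D (zeroPoly-coef n D zero-D))
      where
        I = interpolant (nodes [] S) g
        D = I ⊕ (- + 1 ⊛ g)
        lem : ∀ a b → a + - + 1 * b ≡ a - b
        lem = solve-∀
        eval-D : ∀ y → eval D y ≡ eval I y - eval g y
        eval-D y = trans (deriv-⊕ 0 I (- + 1 ⊛ g) y) (trans (cong (_+_ (eval I y)) (deriv-⊛ 0 (- + 1) g y)) (lem (eval I y) (eval g y)))
        zero-D : ZeroPoly D
        zero-D = zeroPoly-of-roots D (map proj₁ S) dist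
          (All.tabulate (λ {y} y∈S → subst (+ p ∣_) (sym (eval-D y)) (p∣x-y (eval-interpolant S g dist y∈S))))
          (subst (length D ℕ.≤_) (sym (trans (Listₚ.length-map proj₁ S) lenS))
            (length-⊕-≤ I (- + 1 ⊛ g) (subst (length I ℕ.≤_) lenS (length-interpolant S g))
                                      (subst (ℕ._≤ suc n) (sym (length-⊛ (- + 1) g)) len-g)))
        coef-D : coef n D ≡ ∑ (nodes [] S) (λ t → weight t * eval g (point t)) - coef n g
        coef-D = trans (coef-⊕ n I (- + 1 ⊛ g))
          (trans (cong₂ _+_ (coef-interpolant-top S n g lenS) (coef-⊛ n (- + 1) g))
                 (lem (∑ (nodes [] S) (λ t → weight t * eval g (point t))) (coef n g)))

    ∑-eval-∣ : ∀ {A : Set} (T : List A) (x v : A → ℤ) n h → length h ℕ.≤ n →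
      (∀ j → j ℕ.< n → + p ∣ ∑ T (λ t → v t * x t ^ j)) → + p ∣ ∑ T (λ t → v t * eval h (x t))
    ∑-eval-∣ T x v n [] _ _ = subst (+ p ∣_) (sym (trans (∑-cong T (λ t → ℤₚ.*-zeroʳ (v t))) (∑-zero T))) ∣0
    ∑-eval-∣ T x v (suc n) (h ∷ hs) (s≤s len) power-sums =
      subst (+ p ∣_) (sym split) (∣m∣n⇒∣m+n (∣n⇒∣m*n h (power-sums 0 (s≤s z≤n)))
        (∑-eval-∣ T x (λ t → v t * x t) n hs len
          (λ j j<n → subst (+ p ∣_) (∑-cong T (λ t → sym (ℤₚ.*-assoc (v t) (x t) (x t ^ j)))) (power-sums (suc j) (s≤s j<n)))))
      where
        lem : ∀ v h c e → v * (h + c * e) ≡ h * (v * + 1) + v * c * e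
        lem = solve-∀
        split : ∑ T (λ t → v t * eval (h ∷ hs) (x t)) ≡ h * ∑ T (λ t → v t * x t ^ 0) + ∑ T (λ t → v t * x t * eval hs (x t))
        split = trans (∑-cong T (λ t → lem (v t) h (x t) (eval hs (x t))))
                  (trans (∑-+ T _ _) (cong (_+ ∑ T (λ t → v t * x t * eval hs (x t))) (∑-*ˡ T h (λ t → v t * + 1))))

    vandermonde : ∀ c e S (v : Node → ℤ) → Distinct (c ∷ map proj₁ S) →
      (∀ j → j ℕ.< suc (length S) → + p ∣ ∑ (nodes [] ((c , e) ∷ S)) (λ t → v t * point t ^ j)) →
      + p ∣ v (node c e (map proj₁ S))
    vandermonde c e S v dist power-sums =
      ∣-cancelʳ (eval-rootPoly-apart O c (AllPairs.head dist))
        (subst (+ p ∣_) only-first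
          (∑-eval-∣ (nodes [] ((c , e) ∷ S)) point v (suc (length S)) (rootPoly O)
            (ℕₚ.≤-reflexive (trans (length-rootPoly O) (cong suc (Listₚ.length-map proj₁ S)))) power-sums))
      where
        O = map proj₁ S
        T = nodes (c ∷ []) S
        rest-vanishes : ∑ T (λ t → v t * eval (rootPoly O) (point t)) ≡ + 0
        rest-vanishes = trans (∑-cong-All {f = λ t → v t * eval (rootPoly O) (point t)} {g = λ _ → + 0}
          (All.map (λ {t} t∈O → trans (cong (v t *_) (eval-rootPoly-∈ O t∈O)) (ℤₚ.*-zeroʳ (v t))) (nodes-point (c ∷ []) S)))
          (∑-zero T)
        only-first : v (node c e O) * eval (rootPoly O) c + ∑ T (λ t → v t * eval (rootPoly O) (point t))
                     ≡ v (node c e O) * eval (rootPoly O) c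
        only-first = trans (cong (_+_ (v (node c e O) * eval (rootPoly O) c)) rest-vanishes) (ℤₚ.+-identityʳ _)

    %-≡⇒≈ : ∀ a b → a % p ≡ b % p → + a ≈ + b
    %-≡⇒≈ a b eq = begin
      + a            ≈⟨ ≈-modℕ (+ a) ⟩
      + (a % p)      ≡⟨ cong +_ eq ⟩
      + (b % p)      ≈⟨ ≈-sym (≈-modℕ (+ b)) ⟩
      + b            ∎
      where open ≈-Reasoning

    ≈⇒%-≡ : ∀ a b → + a ≈ + b → a % p ≡ b % p
    ≈⇒%-≡ a b a≈b with a % p ℕ.≟ b % p
    ... | yes eq = eq
    ... | no  ne = ⊥-elim (apart-ℕ ne (m%n<n a p) (m%n<n b p)
                            (p∣x-y (≈-trans (≈-sym (≈-modℕ (+ a))) (≈-trans a≈b (≈-modℕ (+ b))))))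

  module OddPrime (p : ℕ) (p-prime : Prime p) (d : ℕ) (p≡2d+1 : p ≡ suc (d ℕ.+ d)) where

    open Congruence p
    open PrimeModulus p p-prime

    d<p : d ℕ.< p
    d<p = subst (d ℕ.<_) (sym p≡2d+1) (s≤s (ℕₚ.m≤m+n d d))

    1≤d : 1 ℕ.≤ d
    1≤d = ℕₚ.n≢0⇒n>0 d≢0
      where
        d≢0 : d ≢ 0
        d≢0 d≡0 = ℕₚ.<-irrefl refl (subst (1 ℕ.<_) (trans p≡2d+1 (cong (λ n → suc (n ℕ.+ n)) d≡0)) 1<p)

    fermat-half : ∀ x → ¬ + p ∣ x → x ^ (d ℕ.+ d) ≈ + 1
    fermat-half x p∤x = subst (λ n → x ^ n ≈ + 1) (cong ℕ.pred p≡2d+1) (fermat-unit x p∤x)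

    euler-square : ∀ z → ¬ + p ∣ z → (z * z) ^ d ≈ + 1
    euler-square z p∤z = ≈-trans (≡⇒≈ (trans (^-distribʳ-* z z d) (sym (ℤₚ.^-distribˡ-+-* z d d)))) (fermat-half z p∤z)

    squares : ℕ → List ℤ
    squares zero    = []
    squares (suc n) = + suc n * + suc n ∷ squares n

    length-squares : ∀ n → length (squares n) ≡ n
    length-squares zero    = refl
    length-squares (suc n) = cong suc (length-squares n)

    All-squares : ∀ {P : ℤ → Set} n → (∀ w → 1 ℕ.≤ w → w ℕ.≤ n → P (+ w * + w)) → All P (squares n)
    All-squares zero    h = []
    All-squares (suc n) h = h (suc n) (s≤s z≤n) ℕₚ.≤-refl ∷ All-squares n (λ w 1≤w w≤n → h w 1≤w (ℕₚ.m≤n⇒m≤1+n w≤n))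

    square-apart : ∀ {i j} → 1 ℕ.≤ j → j ℕ.< i → i ℕ.≤ d → Apart (+ i * + i) (+ j * + j)
    square-apart {i} {j} 1≤j j<i i≤d p∣i²-j² = ∤-* (apart-< j<i i<p) i+j≢0
      (subst (+ p ∣_) (lem (+ i) (+ j)) p∣i²-j²)
      where
        i<p = ℕₚ.≤-<-trans i≤d d<p
        lem : ∀ a b → a * a - b * b ≡ (a - b) * (a + b)
        lem = solve-∀
        i+j≢0 : ¬ + p ∣ + i + + j
        i+j≢0 = subst (λ z → ¬ + p ∣ z) (ℤₚ.pos-+ i j)
          (∤-pos (ℕₚ.<-≤-trans (s≤s z≤n) (ℕₚ.≤-trans 1≤j (ℕₚ.m≤n+m j i)))
                 (subst (i ℕ.+ j ℕ.<_) (sym p≡2d+1) (s≤s (ℕₚ.+-mono-≤ i≤d (ℕₚ.≤-trans (ℕₚ.<⇒≤ j<i) i≤d)))))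

    squares-distinct : ∀ n → n ℕ.≤ d → Distinct (squares n)
    squares-distinct zero    _   = []
    squares-distinct (suc n) n<d =
      All-squares n (λ j 1≤j j≤n → square-apart 1≤j (s≤s j≤n) n<d) ∷ squares-distinct n (ℕₚ.<⇒≤ n<d)

    halfPoly : Poly
    halfPoly = (- + 1 ∷ []) ⊕ monomial d

    eval-halfPoly : ∀ y → eval halfPoly y ≡ - + 1 + y ^ d
    eval-halfPoly y = trans (deriv-⊕ 0 (- + 1 ∷ []) (monomial d) y)
                            (cong₂ _+_ (eval-const (- + 1) y) (eval-monomial d y))

    halfPoly-root : ∀ y → y ^ d ≈ + 1 → + p ∣ eval halfPoly y
    halfPoly-root y y^d≈1 = ≈0⇒∣ (≈-trans (≡⇒≈ (eval-halfPoly y)) (+-cong (≈-refl { - + 1}) y^d≈1))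

    length-halfPoly : length halfPoly ≡ suc d
    length-halfPoly = trans (length-⊕ (- + 1 ∷ []) (monomial d))
                            (trans (cong (1 ℕ.⊔_) (length-monomial d)) (ℕₚ.m≤n⇒m⊔n≡n (s≤s z≤n)))

    coef-halfPoly-top : coef d halfPoly ≡ + 1
    coef-halfPoly-top = trans (coef-⊕ d (- + 1 ∷ []) (monomial d))
      (trans (cong₂ _+_ (coef-beyond d (- + 1 ∷ []) 1≤d) (coef-monomial-self d)) (ℤₚ.+-identityˡ (+ 1)))

    euler-dichotomy : ∀ x → ¬ + p ∣ x → x ^ d ≈ + 1 ⊎ x ^ d ≈ - + 1
    euler-dichotomy x p∤x = Sum.map mk≈ (λ p∣x^d+1 → mk≈ (subst (+ p ∣_) (lem₂ (x ^ d)) p∣x^d+1))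
                                    (euclid (x ^ d - + 1) (x ^ d + + 1) p∣x²ᵈ-1)
      where
        lem₁ : ∀ y → y * y - + 1 ≡ (y - + 1) * (y + + 1)
        lem₁ = solve-∀
        lem₂ : ∀ y → y + + 1 ≡ y - - + 1
        lem₂ = solve-∀
        p∣x²ᵈ-1 : + p ∣ (x ^ d - + 1) * (x ^ d + + 1)
        p∣x²ᵈ-1 = subst (+ p ∣_) (trans (cong (_- + 1) (ℤₚ.^-distribˡ-+-* x d d)) (lem₁ (x ^ d))) (p∣x-y (fermat-half x p∤x))

    squares-are-roots : All (λ y → + p ∣ eval halfPoly y) (squares d)
    squares-are-roots = All-squares {λ y → + p ∣ eval halfPoly y} d (λ w 1≤w w≤d → halfPoly-root (+ w * + w)
      (euler-square (+ w) (∤-pos 1≤w (ℕₚ.≤-<-trans w≤d d<p))))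

    -- x together with the d nonzero squares would be d + 1 roots of Xᵈ - 1.
    nonsquare-not-residue : ∀ x → (∀ w → 1 ℕ.≤ w → w ℕ.≤ d → Apart x (+ w * + w)) → ¬ x ^ d ≈ + 1
    nonsquare-not-residue x nonsquare x^d≈1 = ∤1 (subst (+ p ∣_) coef-halfPoly-top (zeroPoly-coef d halfPoly halfPoly≡0))
      where
        halfPoly≡0 : ZeroPoly halfPoly
        halfPoly≡0 = zeroPoly-of-roots halfPoly (x ∷ squares d)
          (All-squares {Apart x} d nonsquare ∷ squares-distinct d ℕₚ.≤-refl)
          (halfPoly-root x x^d≈1 ∷ squares-are-roots)
          (ℕₚ.≤-reflexive (trans length-halfPoly (cong suc (sym (length-squares d)))))

    euler-nonsquare : ∀ x → ¬ + p ∣ x → (∀ w → 1 ℕ.≤ w → w ℕ.≤ d → Apart x (+ w * + w)) → x ^ d ≈ - + 1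
    euler-nonsquare x p∤x nonsquare =
      Sum.[ (λ x^d≈1 → ⊥-elim (nonsquare-not-residue x nonsquare x^d≈1)) , id ]′ (euler-dichotomy x p∤x)

    Aligned : List (ℤ × ℤ) → ℤ → Set
    Aligned S x = Σ ℤ λ α → All (λ ce → Apart x (proj₁ ce) → (x - proj₁ ce) ^ d ≈ α * proj₂ ce) S

    ∣-^ : ∀ {y} r → 1 ℕ.≤ r → + p ∣ y → + p ∣ y ^ r
    ∣-^ {y} (suc r) _ p∣y = ∣m⇒∣m*n (y ^ r) p∣y

    aligned-term : ∀ {x c α ε} u r → 1 ℕ.≤ r → ε * ε ≡ + 1 → (Apart x c → (x - c) ^ d ≈ α * ε) →
      ε * u * (x - c) ^ (d ℕ.+ r) ≈ α * (u * (x - c) ^ r)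
    aligned-term {x} {c} {α} {ε} u r 1≤r ε²≡1 χ with + p ∣? x - c
    ... | no x≉c = begin
      ε * u * (x - c) ^ (d ℕ.+ r)              ≡⟨ cong (ε * u *_) (ℤₚ.^-distribˡ-+-* (x - c) d r) ⟩
      ε * u * ((x - c) ^ d * (x - c) ^ r)      ≈⟨ *-cong (≈-refl {ε * u}) (*-cong (χ x≉c) (≈-refl {(x - c) ^ r})) ⟩
      ε * u * (α * ε * (x - c) ^ r)            ≡⟨ lem ε u α ((x - c) ^ r) ⟩
      ε * ε * (α * (u * (x - c) ^ r))          ≡⟨ cong (_* (α * (u * (x - c) ^ r))) ε²≡1 ⟩
      + 1 * (α * (u * (x - c) ^ r))            ≡⟨ ℤₚ.*-identityˡ _ ⟩
      α * (u * (x - c) ^ r)                    ∎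
      where
        open ≈-Reasoning
        lem : ∀ ε u α e → ε * u * (α * ε * e) ≡ ε * ε * (α * (u * e))
        lem = solve-∀
    ... | yes x≈c = mk≈ (∣m∣n⇒∣m-n
      (∣n⇒∣m*n (ε * u) (subst (+ p ∣_) (sym (ℤₚ.^-distribˡ-+-* (x - c) d r)) (∣n⇒∣m*n ((x - c) ^ d) p∣yʳ)))
      (∣n⇒∣m*n α (∣n⇒∣m*n u p∣yʳ)))
      where p∣yʳ = ∣-^ r 1≤r x≈c

    ∤-neg1^ : ∀ j → ¬ + p ∣ (- + 1) ^ j
    ∤-neg1^ j p∣ = ∤1 (subst (+ p ∣_) (trans (sym (^-distribʳ-* (- + 1) (- + 1) j)) (ℤₚ.^-zeroˡ j))
                            (∣m⇒∣m*n ((- + 1) ^ j) p∣))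

    Signed : List (ℤ × ℤ) → Set
    Signed = All (λ ce → proj₂ ce * proj₂ ce ≡ + 1)

    Unsigned : List (ℤ × ℤ) → Set
    Unsigned = All (λ ce → proj₂ ce ≡ + 1)

    -- The first entry of S is split off: it is the node singled out by the Vandermonde argument.
    module WeightedPower (c₀ ε₀ : ℤ) (S′ : List (ℤ × ℤ)) (m : ℕ) (length-S′ : length S′ ≡ suc m) (m≤d : m ℕ.≤ d)
                         (distinct : Distinct (c₀ ∷ map proj₁ S′)) (signs : Signed ((c₀ , ε₀) ∷ S′)) where

      S : List (ℤ × ℤ)
      S = (c₀ , ε₀) ∷ S′

      T : List Node
      T = nodes [] S

      N : ℕ
      N = d ℕ.+ m

      N<p : N ℕ.< p
      N<p = subst (N ℕ.<_) (sym p≡2d+1) (s≤s (ℕₚ.+-monoʳ-≤ d m≤d))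

      w : Node → ℤ
      w t = sign t * weight t

      summand : Node → Poly
      summand t = w t ⊛ linPow (point t) N

      F : Poly
      F = ∑ₚ T summand

      length-F : length F ℕ.≤ suc N
      length-F = length-∑ₚ {T = T} summand (All.tabulate (λ {t} _ → ℕₚ.≤-reflexive
        (trans (length-⊛ (w t) (linPow (point t) N)) (length-linPow (point t) N))))

      deriv-F : ∀ j x → deriv j F x ≡ + fall N j * ∑ T (λ t → w t * (x - point t) ^ (N ℕ.∸ j))
      deriv-F j x = begin
        deriv j F x                                                   ≡⟨ deriv-∑ₚ j T summand x ⟩
        ∑ T (λ t → deriv j (w t ⊛ linPow (point t) N) x)              ≡⟨ ∑-cong T term ⟩
        ∑ T (λ t → + fall N j * (w t * (x - point t) ^ (N ℕ.∸ j)))     ≡⟨ ∑-*ˡ T (+ fall N j) (λ t → w t * (x - point t) ^ (N ℕ.∸ j)) ⟩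
        + fall N j * ∑ T (λ t → w t * (x - point t) ^ (N ℕ.∸ j))       ∎
        where
          open ≡-Reasoning
          lem : ∀ a b c → a * (b * c) ≡ b * (a * c)
          lem = solve-∀
          term : ∀ t → deriv j (w t ⊛ linPow (point t) N) x ≡ + fall N j * (w t * (x - point t) ^ (N ℕ.∸ j))
          term t = trans (deriv-⊛ j (w t) (linPow (point t) N) x)
                     (trans (cong (w t *_) (deriv-linPow (point t) N j x)) (lem (w t) (+ fall N j) ((x - point t) ^ (N ℕ.∸ j))))

      coef-F : ∀ k → + (k !) * coef k F ≡ + fall N k * ∑ T (λ t → w t * (+ 0 - point t) ^ (N ℕ.∸ k))
      coef-F k = trans (sym (deriv-coef k F)) (deriv-F k (+ 0))

      coef-F-∣⇐ : ∀ k → k ℕ.≤ N → + p ∣ ∑ T (λ t → w t * (+ 0 - point t) ^ (N ℕ.∸ k)) → + p ∣ coef k F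
      coef-F-∣⇐ k k≤N p∣∑ = ∣-cancelˡ (∤-! k (ℕₚ.≤-<-trans k≤N N<p))
        (subst (+ p ∣_) (sym (coef-F k)) (∣n⇒∣m*n (+ fall N k) p∣∑))

      coef-F-∣⇒ : ∀ k → k ℕ.≤ N → + p ∣ coef k F → + p ∣ ∑ T (λ t → w t * (+ 0 - point t) ^ (N ℕ.∸ k))
      coef-F-∣⇒ k k≤N p∣coef = ∣-cancelˡ (∤-fall N k k≤N N<p)
        (subst (+ p ∣_) (coef-F k) (∣n⇒∣m*n (+ (k !)) p∣coef))

      power-sum : ∀ x r → r ℕ.≤ suc m → ∑ T (λ t → weight t * (x - point t) ^ r) ≈ coef (suc m) (powFrom x r)
      power-sum x r r≤m+1 = ≈-trans
        (≡⇒≈ (∑-cong T (λ t → cong (weight t *_) (sym (eval-powFrom x r (point t))))))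
        (lagrange-top S (suc m) (cong suc length-S′) distinct (powFrom x r)
          (ℕₚ.≤-trans (ℕₚ.≤-reflexive (length-powFrom x r)) (s≤s r≤m+1)))

      power-sum-low : ∀ x r → r ℕ.≤ m → ∑ T (λ t → weight t * (x - point t) ^ r) ≈ + 0
      power-sum-low x r r≤m = ≈-trans (power-sum x r (ℕₚ.m≤n⇒m≤1+n r≤m))
        (≡⇒≈ (coef-beyond (suc m) (powFrom x r) (ℕₚ.≤-trans (ℕₚ.≤-reflexive (length-powFrom x r)) (s≤s r≤m))))

      power-sum-top : ∑ T (λ t → weight t * (+ 0 - point t) ^ suc m) ≈ (- + 1) ^ suc m
      power-sum-top = ≈-trans (power-sum (+ 0) (suc m) ℕₚ.≤-refl) (≡⇒≈ (coef-powFrom-top (+ 0) (suc m)))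

      vanishes-at-aligned : ∀ {x} → Aligned S x → VanishesToOrder m F x
      vanishes-at-aligned {x} (α , χ) j j<m = ≈0⇒∣ (begin
        deriv j F x                                                    ≡⟨ deriv-F j x ⟩
        + fall N j * ∑ T (λ t → w t * (x - point t) ^ (N ℕ.∸ j))        ≡⟨ cong (λ n → + fall N j * ∑ T (λ t → w t * (x - point t) ^ n)) N-j≡d+r ⟩
        + fall N j * ∑ T (λ t → w t * (x - point t) ^ (d ℕ.+ r))        ≈⟨ *-cong (≈-refl {+ fall N j}) (∑-≈ T terms) ⟩
        + fall N j * ∑ T (λ t → α * (weight t * (x - point t) ^ r))     ≡⟨ cong (+ fall N j *_) (∑-*ˡ T α _) ⟩
        + fall N j * (α * ∑ T (λ t → weight t * (x - point t) ^ r))     ≈⟨ *-cong (≈-refl {+ fall N j}) (*-cong (≈-refl {α}) (power-sum-low x r (ℕₚ.m∸n≤m m j))) ⟩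
        + fall N j * (α * + 0)                                         ≡⟨ lem (+ fall N j) α ⟩
        + 0                                                            ∎)
        where
          open ≈-Reasoning
          r = m ℕ.∸ j
          N-j≡d+r : N ℕ.∸ j ≡ d ℕ.+ r
          N-j≡d+r = ℕₚ.+-∸-assoc d (ℕₚ.<⇒≤ j<m)
          lem : ∀ a b → a * (b * + 0) ≡ + 0
          lem = solve-∀
          terms : All (λ t → w t * (x - point t) ^ (d ℕ.+ r) ≈ α * (weight t * (x - point t) ^ r)) T
          terms = All.map (λ {t} h → aligned-term {x} {point t} {α} {sign t} (weight t) r (ℕₚ.m<n⇒0<n∸m j<m) (proj₂ h) (proj₁ h))
                          (nodes-labels [] S (All.zip (χ , signs)))

      power-sum-from-coef : ∀ j → j ℕ.≤ N → + p ∣ coef (N ℕ.∸ j) F → + p ∣ ∑ T (λ t → w t * point t ^ j)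
      power-sum-from-coef j j≤N p∣coef =
        ∣-cancelˡ (∤-neg1^ j) (subst (+ p ∣_) rearrange (coef-F-∣⇒ (N ℕ.∸ j) (ℕₚ.m∸n≤m N j) p∣coef))
        where
          lem₀ : ∀ c → + 0 - c ≡ - + 1 * c
          lem₀ = solve-∀
          lem₁ : ∀ a b c → a * (b * c) ≡ b * (a * c)
          lem₁ = solve-∀
          term : ∀ t → w t * (+ 0 - point t) ^ j ≡ (- + 1) ^ j * (w t * point t ^ j)
          term t = trans (cong (w t *_) (trans (cong (_^ j) (lem₀ (point t))) (^-distribʳ-* (- + 1) (point t) j)))
                         (lem₁ (w t) ((- + 1) ^ j) (point t ^ j))
          rearrange : ∑ T (λ t → w t * (+ 0 - point t) ^ (N ℕ.∸ (N ℕ.∸ j))) ≡ (- + 1) ^ j * ∑ T (λ t → w t * point t ^ j)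
          rearrange = trans (cong (λ n → ∑ T (λ t → w t * (+ 0 - point t) ^ n)) (ℕₚ.m∸[m∸n]≡n j≤N))
                            (trans (∑-cong T term) (∑-*ˡ T ((- + 1) ^ j) _))

      -- By the Vandermonde argument, vanishing of all coefficients would force the first weight to vanish.
      F≢0 : ¬ (∀ k → k ℕ.≤ N → + p ∣ coef k F)
      F≢0 all-zero = ∤1 (∣-resp-≈ (invProd-inverseˡ O c₀ c₀≉O) (∣m⇒∣m*n (eval (rootPoly O) c₀) p∣u₀))
        where
          O = map proj₁ S′
          c₀≉O : All (Apart c₀) O
          c₀≉O = AllPairs.head distinct
          p∣w₀ : + p ∣ ε₀ * invProd O c₀
          p∣w₀ = vandermonde c₀ ε₀ S′ w distinct (λ j j<l → power-sum-from-coef j (j≤N j<l)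
                   (all-zero (N ℕ.∸ j) (ℕₚ.m∸n≤m N j)))
            where
              j≤N : ∀ {j} → j ℕ.< suc (length S′) → j ℕ.≤ N
              j≤N {j} j<l = ℕₚ.≤-trans (ℕₚ.≤-pred (subst (j ℕ.<_) (cong suc length-S′) j<l)) (ℕₚ.+-monoˡ-≤ m 1≤d)
          p∣u₀ : + p ∣ invProd O c₀
          p∣u₀ = subst (+ p ∣_) (square-one-cancelˡ ε₀ (invProd O c₀) (All.head signs)) (∣n⇒∣m*n ε₀ p∣w₀)

      nonzero-coef : Σ ℕ λ k → k ℕ.≤ N × ¬ + p ∣ coef k F
      nonzero-coef = from-Fin (Finₚ.¬∀⟶∃¬ (suc N) (λ i → + p ∣ coef (toℕ i) F) (λ i → + p ∣? coef (toℕ i) F)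
        (λ all-zero → F≢0 (λ k k≤N → subst (λ n → + p ∣ coef n F) (Finₚ.toℕ-fromℕ< (s≤s k≤N)) (all-zero _))))
        where
          from-Fin : Σ (Fin (suc N)) (λ i → ¬ + p ∣ coef (toℕ i) F) → Σ ℕ λ k → k ℕ.≤ N × ¬ + p ∣ coef k F
          from-Fin (i , p∤coef) = toℕ i , ℕₚ.≤-pred (Finₚ.toℕ<n i) , p∤coef

      coef-beyond-F : ∀ k → N ℕ.< k → + p ∣ coef k F
      coef-beyond-F k N<k = subst (+ p ∣_) (sym (coef-beyond k F (ℕₚ.≤-trans length-F N<k))) ∣0

      aligned-roots≤ : ∀ M k → k ℕ.≤ M → ¬ + p ∣ coef k F → (∀ i → M ℕ.< i → + p ∣ coef i F) →
        ∀ X → Distinct X → All (Aligned S) X → length X ℕ.* m ℕ.≤ M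
      aligned-roots≤ M k k≤M p∤coef high X dist aligned = subst (ℕ._≤ M) (sum-points X)
        (rootMultiplicities≤ F M k k≤M p∤coef high (map (_, m) X) (AllPairsₚ.map⁺ dist)
          (Allₚ.map⁺ (All.tabulate (λ _ → ℕₚ.≤-trans m≤d (ℕₚ.<⇒≤ d<p))))
          (Allₚ.map⁺ (All.map vanishes-at-aligned aligned)))
        where
          sum-points : ∀ X → sum (map proj₂ (map (_, m) X)) ≡ length X ℕ.* m
          sum-points []      = refl
          sum-points (x ∷ X) = cong (m ℕ.+_) (sum-points X)

      aligned-bound : ∀ X → Distinct X → All (Aligned S) X → length X ℕ.* m ℕ.≤ d ℕ.+ m
      aligned-bound = aligned-roots≤ N (proj₁ nonzero-coef) (proj₁ (proj₂ nonzero-coef)) (proj₂ (proj₂ nonzero-coef)) coef-beyond-F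

      -- With all signs 1, F has degree exactly d - 1 modulo p.
      aligned-bound-unsigned : Unsigned S → ∀ X → Distinct X → All (Aligned S) X →
        suc (length X ℕ.* m) ℕ.≤ d
      aligned-bound-unsigned ones X dist aligned = subst (suc (length X ℕ.* m) ℕ.≤_) (ℕₚ.suc-pred d {{ℕ.>-nonZero 1≤d}})
        (s≤s (aligned-roots≤ (ℕ.pred d) (ℕ.pred d) ℕₚ.≤-refl p∤top high X dist aligned))
        where
          unsigned : ∀ f → ∑ T (λ t → w t * f t) ≡ ∑ T (λ t → weight t * f t)
          unsigned f = ∑-cong-All {f = λ t → w t * f t} {g = λ t → weight t * f t}
            (All.map (λ {t} ε≡1 → cong (_* f t) (trans (cong (_* weight t) ε≡1) (ℤₚ.*-identityˡ (weight t))))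
                                           (nodes-labels {λ ce → proj₂ ce ≡ + 1} [] S ones))
          d≡1+d-1 : d ≡ suc (ℕ.pred d)
          d≡1+d-1 = sym (ℕₚ.suc-pred d {{ℕ.>-nonZero 1≤d}})
          N-top : N ℕ.∸ ℕ.pred d ≡ suc m
          N-top = trans (cong (λ n → n ℕ.+ m ℕ.∸ ℕ.pred d) d≡1+d-1)
                        (trans (cong (ℕ._∸ ℕ.pred d) (sym (ℕₚ.+-suc (ℕ.pred d) m))) (ℕₚ.m+n∸m≡n (ℕ.pred d) (suc m)))
          p∤top : ¬ + p ∣ coef (ℕ.pred d) F
          p∤top p∣coef = ∤-neg1^ (suc m) (∣-resp-≈ power-sum-top
            (subst (+ p ∣_) (trans (unsigned (λ t → (+ 0 - point t) ^ (N ℕ.∸ ℕ.pred d))) (cong (λ n → ∑ T (λ t → weight t * (+ 0 - point t) ^ n)) N-top))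
                   (coef-F-∣⇒ (ℕ.pred d) (ℕₚ.≤-trans ℕₚ.pred[n]≤n (ℕₚ.m≤m+n d m)) p∣coef)))
          high : ∀ k → ℕ.pred d ℕ.< k → + p ∣ coef k F
          high k d-1<k = high-by-cases (k ℕ.≤? N)
            where
              N-k≤m : N ℕ.∸ k ℕ.≤ m
              N-k≤m = ℕₚ.≤-trans (ℕₚ.∸-monoʳ-≤ N (subst (ℕ._≤ k) (sym d≡1+d-1) d-1<k)) (ℕₚ.≤-reflexive (ℕₚ.m+n∸m≡n d m))
              high-by-cases : Dec (k ℕ.≤ N) → + p ∣ coef k F
              high-by-cases (no  k≰N) = coef-beyond-F k (ℕₚ.≰⇒> k≰N)
              high-by-cases (yes k≤N) = coef-F-∣⇐ k k≤N
                (subst (+ p ∣_) (sym (unsigned (λ t → (+ 0 - point t) ^ (N ℕ.∸ k)))) (≈0⇒∣ (power-sum-low (+ 0) (N ℕ.∸ k) N-k≤m)))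

    aligned-take : ∀ n {S x} → Aligned S x → Aligned (take n S) x
    aligned-take n (α , χ) = α , Allₚ.take⁺ n χ

    distinct-take : ∀ n S → Distinct (map proj₁ S) → Distinct (map proj₁ (take n S))
    distinct-take n S dist =
      AllPairsₚ.map⁺ {f = proj₁ {B = λ _ → ℤ}} (AllPairsₚ.take⁺ n (AllPairsₚ.map⁻ {f = proj₁ {B = λ _ → ℤ}} dist))

    length-take-≤-length : ∀ {A : Set} n (S : List A) → n ℕ.≤ length S → length (take n S) ≡ n
    length-take-≤-length n S n≤S = trans (Listₚ.length-take n S) (ℕₚ.m≤n⇒m⊓n≡m n≤S)

    aligned-bound-short : ∀ S X → Distinct (map proj₁ S) → Signed S → Distinct X → All (Aligned S) X →
      2 ℕ.≤ length S → length S ℕ.≤ 2 ℕ.+ d → length X ℕ.* (length S ℕ.∸ 2) ℕ.≤ d ℕ.+ (length S ℕ.∸ 2)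
    aligned-bound-short ((c₀ , ε₀) ∷ ce ∷ S) X dist signs distX aligned (s≤s (s≤s _)) (s≤s (s≤s S≤d)) =
      WeightedPower.aligned-bound c₀ ε₀ (ce ∷ S) (length S) refl S≤d dist signs X distX aligned

    aligned-bound-short-unsigned : ∀ S X → Distinct (map proj₁ S) → Unsigned S → Distinct X → All (Aligned S) X →
      2 ℕ.≤ length S → length S ℕ.≤ 2 ℕ.+ d → suc (length X ℕ.* (length S ℕ.∸ 2)) ℕ.≤ d
    aligned-bound-short-unsigned ((c₀ , ε₀) ∷ ce ∷ S) X dist ones distX aligned (s≤s (s≤s _)) (s≤s (s≤s S≤d)) =
      WeightedPower.aligned-bound-unsigned c₀ ε₀ (ce ∷ S) (length S) refl S≤d dist
        (All.map (λ ε≡1 → cong (λ ε → ε * ε) ε≡1) ones) ones X distX aligned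

    short-or-truncated : ∀ {Q : List (ℤ × ℤ) → Set} X (R : ℕ → Set) → (∀ n {S} → Q S → Q (take n S)) →
      (∀ S → Distinct (map proj₁ S) → Q S → All (Aligned S) X → 2 ℕ.≤ length S → length S ℕ.≤ 2 ℕ.+ d → R (length S)) →
      ∀ S → Distinct (map proj₁ S) → Q S → All (Aligned S) X → 2 ℕ.≤ length S → R (length S) ⊎ R (2 ℕ.+ d)
    short-or-truncated X R take-Q short S dist q aligned 2≤S = by-cases (length S ℕ.≤? 2 ℕ.+ d)
      where
        by-cases : Dec (length S ℕ.≤ 2 ℕ.+ d) → R (length S) ⊎ R (2 ℕ.+ d)
        by-cases (yes S≤) = inj₁ (short S dist q aligned 2≤S S≤)
        by-cases (no  S≰) = inj₂ (subst R len (short (take (2 ℕ.+ d) S) (distinct-take (2 ℕ.+ d) S dist)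
          (take-Q (2 ℕ.+ d) q) (All.map (λ {x} → aligned-take (2 ℕ.+ d) {S} {x}) aligned)
          (subst (2 ℕ.≤_) (sym len) (s≤s (s≤s z≤n))) (ℕₚ.≤-reflexive len)))
          where
            len : length (take (2 ℕ.+ d) S) ≡ 2 ℕ.+ d
            len = length-take-≤-length (2 ℕ.+ d) S (ℕₚ.<⇒≤ (ℕₚ.≰⇒> S≰))

    aligned-bound : ∀ S X → Distinct (map proj₁ S) → Signed S → Distinct X → All (Aligned S) X → 2 ℕ.≤ length S →
      length X ℕ.* (length S ℕ.∸ 2) ℕ.≤ d ℕ.+ (length S ℕ.∸ 2) ⊎ length X ℕ.* d ℕ.≤ d ℕ.+ d
    aligned-bound S X dist signs distX = short-or-truncated X (λ n → length X ℕ.* (n ℕ.∸ 2) ℕ.≤ d ℕ.+ (n ℕ.∸ 2))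
      (λ n → Allₚ.take⁺ n) (λ S′ dist′ signs′ → aligned-bound-short S′ X dist′ signs′ distX) S dist signs

    aligned-bound-unsigned : ∀ S X → Distinct (map proj₁ S) → Unsigned S → Distinct X → All (Aligned S) X → 2 ℕ.≤ length S →
      suc (length X ℕ.* (length S ℕ.∸ 2)) ℕ.≤ d ⊎ suc (length X ℕ.* d) ℕ.≤ d
    aligned-bound-unsigned S X dist ones distX = short-or-truncated X (λ n → suc (length X ℕ.* (n ℕ.∸ 2)) ℕ.≤ d)
      (λ n → Allₚ.take⁺ n) (λ S′ dist′ ones′ → aligned-bound-short-unsigned S′ X dist′ ones′ distX) S dist ones

  excess : ℕ → ℕ → ℕ
  excess a b = (a ℕ.* a ℕ.∸ 2 ℕ.* a) ℕ.⊓ (b ℕ.* b ℕ.∸ 2 ℕ.* b) ℕ.+ a ℕ.* b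

  square-∸-double : ∀ a → (2 ℕ.+ a) ℕ.* (2 ℕ.+ a) ℕ.∸ 2 ℕ.* (2 ℕ.+ a) ≡ (2 ℕ.+ a) ℕ.* a
  square-∸-double a = trans (cong (ℕ._∸ 2 ℕ.* (2 ℕ.+ a)) (lem a)) (ℕₚ.m+n∸m≡n (2 ℕ.* (2 ℕ.+ a)) ((2 ℕ.+ a) ℕ.* a))
    where lem : ∀ a → (2 ℕ.+ a) ℕ.* (2 ℕ.+ a) ≡ 2 ℕ.* (2 ℕ.+ a) ℕ.+ (2 ℕ.+ a) ℕ.* a
          lem = ℕ-Ring.solve-∀

  -- Writing n = a + b, the minimum is at most a² - 2a, and a² - 2a + ab = a (n - 2).
  excess≤ˡ : ∀ a b → 2 ℕ.≤ a → 2 ℕ.≤ b → excess a b ℕ.≤ a ℕ.* (a ℕ.+ b ℕ.∸ 2)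
  excess≤ˡ (suc (suc a)) (suc (suc b)) (s≤s (s≤s _)) (s≤s (s≤s _)) = ℕₚ.≤-trans
    (ℕₚ.+-monoˡ-≤ _ (ℕₚ.≤-trans (ℕₚ.m⊓n≤m _ _) (ℕₚ.≤-reflexive (square-∸-double a))))
    (ℕₚ.≤-reflexive (lem a b))
    where lem : ∀ a b → (2 ℕ.+ a) ℕ.* a ℕ.+ (2 ℕ.+ a) ℕ.* (2 ℕ.+ b) ≡ (2 ℕ.+ a) ℕ.* (a ℕ.+ (2 ℕ.+ b))
          lem = ℕ-Ring.solve-∀

  excess-comm : ∀ a b → excess a b ≡ excess b a
  excess-comm a b = cong₂ ℕ._+_ (ℕₚ.⊓-comm _ _) (ℕₚ.*-comm a b)

  excess≤ʳ : ∀ a b → 2 ℕ.≤ a → 2 ℕ.≤ b → excess a b ℕ.≤ b ℕ.* (a ℕ.+ b ℕ.∸ 2)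
  excess≤ʳ a b 2≤a 2≤b = subst₂ (λ e n → e ℕ.≤ b ℕ.* (n ℕ.∸ 2)) (excess-comm b a) (ℕₚ.+-comm b a) (excess≤ˡ b a 2≤b 2≤a)

  excess<ˡ : ∀ a b d → 2 ℕ.≤ a → 2 ℕ.≤ b → suc (a ℕ.* (a ℕ.+ b ℕ.∸ 2)) ℕ.≤ d → excess a b ℕ.≤ d
  excess<ˡ a b d 2≤a 2≤b bound = ℕₚ.≤-trans (excess≤ˡ a b 2≤a 2≤b) (ℕₚ.<⇒≤ bound)

  excess<ʳ : ∀ a b d → 2 ℕ.≤ a → 2 ℕ.≤ b → suc (b ℕ.* (a ℕ.+ b ℕ.∸ 2)) ℕ.≤ d → excess a b ℕ.≤ d
  excess<ʳ a b d 2≤a 2≤b bound = ℕₚ.≤-trans (excess≤ʳ a b 2≤a 2≤b) (ℕₚ.<⇒≤ bound)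

  -- From n (n - 2) ≤ d + (n - 2) we get (n - 1)(n - 2) ≤ d, and a ≤ n - 1.
  excess≤-joint : ∀ a b d → 2 ℕ.≤ a → 2 ℕ.≤ b → (a ℕ.+ b) ℕ.* (a ℕ.+ b ℕ.∸ 2) ℕ.≤ d ℕ.+ (a ℕ.+ b ℕ.∸ 2) →
    excess a b ℕ.≤ d
  excess≤-joint a@(suc (suc a′)) b@(suc (suc b′)) d 2≤a@(s≤s (s≤s _)) 2≤b@(s≤s (s≤s _)) bound =
    ℕₚ.≤-trans (excess≤ˡ a b 2≤a 2≤b) (ℕₚ.≤-trans (ℕₚ.*-monoˡ-≤ m a≤1+m) (ℕₚ.+-cancelˡ-≤ m (suc m ℕ.* m) d (subst ((a ℕ.+ b) ℕ.* m ℕ.≤_) (ℕₚ.+-comm d m) bound)))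
    where
      m = a′ ℕ.+ (2 ℕ.+ b′)
      a≤1+m : a ℕ.≤ suc m
      a≤1+m = s≤s (subst (ℕ._≤ m) (ℕₚ.+-comm a′ 1) (ℕₚ.+-monoʳ-≤ a′ (s≤s z≤n)))

  joint-long-impossible : ∀ a b d → 2 ℕ.≤ a → 2 ℕ.≤ b → 1 ℕ.≤ d → ¬ (a ℕ.+ b) ℕ.* d ℕ.≤ d ℕ.+ d
  joint-long-impossible (suc (suc a)) (suc (suc b)) d (s≤s (s≤s _)) (s≤s (s≤s _)) 1≤d bound = ℕₚ.<-irrefl refl (ℕₚ.≤-trans 2d<4d bound)
    where
      lem : ∀ a b d → (2 ℕ.+ a ℕ.+ (2 ℕ.+ b)) ℕ.* d ≡ (d ℕ.+ d) ℕ.+ (d ℕ.+ (1 ℕ.+ a ℕ.+ b) ℕ.* d)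
      lem = ℕ-Ring.solve-∀
      2d<4d : suc (d ℕ.+ d) ℕ.≤ (2 ℕ.+ a ℕ.+ (2 ℕ.+ b)) ℕ.* d
      2d<4d = subst₂ ℕ._≤_ (ℕₚ.+-comm (d ℕ.+ d) 1) (sym (lem a b d))
                           (ℕₚ.+-monoʳ-≤ (d ℕ.+ d) (ℕₚ.≤-trans 1≤d (ℕₚ.m≤m+n d ((1 ℕ.+ a ℕ.+ b) ℕ.* d))))

  single-long-impossible : ∀ a d → 1 ℕ.≤ a → ¬ suc (a ℕ.* d) ℕ.≤ d
  single-long-impossible (suc a) d _ bound = ℕₚ.<-irrefl refl (ℕₚ.≤-trans (s≤s (ℕₚ.m≤m+n d (a ℕ.* d))) bound)

  excess-conclusion : ∀ e d → e ℕ.≤ d → 2 ℕ.* (e ℕ.+ 2) ℕ.≤ suc (d ℕ.+ d) ℕ.+ 3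
  excess-conclusion e d e≤d = subst (2 ℕ.* (e ℕ.+ 2) ℕ.≤_) (lem d) (ℕₚ.*-monoʳ-≤ 2 (ℕₚ.+-monoˡ-≤ 2 e≤d))
    where lem : ∀ d → 2 ℕ.* (d ℕ.+ 2) ≡ suc (d ℕ.+ d) ℕ.+ 3
          lem = ℕ-Ring.solve-∀

  open import Data.Bool using (true; false)
  open import Data.Vec using ([]; _∷_; here; there)
  open import Data.Fin.Subset using (Subset; _∈_; _∉_; ∣_∣)
  open import Data.Fin.Subset.Properties using (_∈?_)

  elements : ∀ {n} → Subset n → List (Fin n)
  elements []            = []
  elements (true  ∷ s) = Fin.zero ∷ map Fin.suc (elements s)
  elements (false ∷ s) = map Fin.suc (elements s)

  length-elements : ∀ {n} (s : Subset n) → length (elements s) ≡ ∣ s ∣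
  length-elements []            = refl
  length-elements (true  ∷ s) = cong suc (trans (Listₚ.length-map Fin.suc (elements s)) (length-elements s))
  length-elements (false ∷ s) = trans (Listₚ.length-map Fin.suc (elements s)) (length-elements s)

  ∈-elements : ∀ {n} (s : Subset n) {x} → x ∈ᴸ elements s → x ∈ s
  ∈-elements (true  ∷ s) (here refl) = here
  ∈-elements (true  ∷ s) (there x∈s) with ∈-map⁻ Fin.suc x∈s
  ... | y , y∈s , refl = there (∈-elements s y∈s)
  ∈-elements (false ∷ s) x∈s with ∈-map⁻ Fin.suc x∈s
  ... | y , y∈s , refl = there (∈-elements s y∈s)

  elements-distinct : ∀ {n} (s : Subset n) → AllPairs _≢_ (elements s)
  elements-distinct []            = []
  elements-distinct (true  ∷ s) =
    Allₚ.map⁺ (All.tabulate (λ _ ())) ∷ AllPairsₚ.map⁺ (AllPairs.map (λ x≢y → x≢y ∘ Finₚ.suc-injective) (elements-distinct s))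
  elements-distinct (false ∷ s) = AllPairsₚ.map⁺ (AllPairs.map (λ x≢y → x≢y ∘ Finₚ.suc-injective) (elements-distinct s))

  two-elements : ∀ {n} (s : Subset n) → 2 ℕ.≤ ∣ s ∣ → Σ (Fin n) λ x → Σ (Fin n) λ y → x ∈ s × y ∈ s × x ≢ y
  two-elements s 2≤s = pick (elements s) (subst (2 ℕ.≤_) (sym (length-elements s)) 2≤s) (elements-distinct s)
    (All.tabulate (∈-elements s))
    where
      pick : ∀ L → 2 ℕ.≤ length L → AllPairs _≢_ L → All (_∈ s) L → Σ (Fin _) λ x → Σ (Fin _) λ y → x ∈ s × y ∈ s × x ≢ y
      pick (x ∷ y ∷ L) (s≤s (s≤s _)) ((x≢y ∷ _) ∷ _) (x∈s ∷ y∈s ∷ _) = x , y , x∈s , y∈s , x≢y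

  data IsSign : ℤ → Set where
    plus  : IsSign (+ 1)
    minus : IsSign (- + 1)

  sign² : ∀ {σ} → IsSign σ → σ * σ ≡ + 1
  sign² plus = refl
  sign² minus = refl


  sign-pigeonhole : ∀ {σ τ υ} → IsSign σ → IsSign τ → IsSign υ → σ ≢ τ → υ ≡ σ ⊎ υ ≡ τ
  sign-pigeonhole plus plus _  σ≢τ = ⊥-elim (σ≢τ refl)
  sign-pigeonhole minus minus _  σ≢τ = ⊥-elim (σ≢τ refl)
  sign-pigeonhole plus minus plus _   = inj₁ refl
  sign-pigeonhole plus minus minus _   = inj₂ refl
  sign-pigeonhole minus plus plus _   = inj₂ refl
  sign-pigeonhole minus plus minus _   = inj₁ refl

  module DifferenceSets (p : ℕ) (p-prime : Prime p) (d : ℕ) (p≡2d+1 : p ≡ suc (d ℕ.+ d)) where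

    open Congruence p
    open PrimeModulus p p-prime
    open OddPrime p p-prime d p≡2d+1

    ι : Fin p → ℤ
    ι x = + toℕ x

    apart-Fin : ∀ {x y} → x ≢ y → Apart (ι x) (ι y)
    apart-Fin {x} {y} x≢y = apart-ℕ (x≢y ∘ Finₚ.toℕ-injective) (Finₚ.toℕ<n x) (Finₚ.toℕ<n y)

    ι-square-+ : ∀ z y → + (toℕ z ℕ.* toℕ z ℕ.+ toℕ y) ≡ ι z * ι z + ι y
    ι-square-+ z y = trans (ℤₚ.pos-+ (toℕ z ℕ.* toℕ z) (toℕ y)) (cong (_+ ι y) (ℤₚ.pos-* (toℕ z) (toℕ z)))

    square-character : ∀ x y → x ≢ y → IsSquareDiff p x y → (ι x - ι y) ^ d ≈ + 1
    square-character x y x≢y (z , eq) = ≈-trans (^-cong d x-y≈z²) (euler-square (ι z) z≢0)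
      where
        z²+y≈x : ι z * ι z + ι y ≈ ι x
        z²+y≈x = subst (_≈ ι x) (ι-square-+ z y) (%-≡⇒≈ _ (toℕ x) eq)
        lem : ∀ a b c → a - b - c * c ≡ - ((c * c + b) - a)
        lem = solve-∀
        x-y≈z² : ι x - ι y ≈ ι z * ι z
        x-y≈z² = mk≈ (subst (+ p ∣_) (sym (lem (ι x) (ι y) (ι z))) (∣m⇒∣-m (p∣x-y z²+y≈x)))
        z≢0 : ¬ + p ∣ ι z
        z≢0 p∣z = apart-Fin x≢y (∣-resp-≈ (≈-sym x-y≈z²) (∣n⇒∣m*n (ι z) p∣z))

    nonsquare-character : ∀ x y → x ≢ y → ¬ IsSquareDiff p x y → (ι x - ι y) ^ d ≈ - + 1
    nonsquare-character x y x≢y nonsquare = euler-nonsquare (ι x - ι y) (apart-Fin x≢y) not-square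
      where
        lem : ∀ a b c → - (a - b - c * c) ≡ (c * c + b) - a
        lem = solve-∀
        not-square : ∀ w → 1 ℕ.≤ w → w ℕ.≤ d → Apart (ι x - ι y) (+ w * + w)
        not-square w _ w≤d p∣ = nonsquare (fromℕ< w<p , subst (λ v → (v ℕ.* v ℕ.+ toℕ y) % p ≡ toℕ x % p)
            (sym (Finₚ.toℕ-fromℕ< w<p))
            (≈⇒%-≡ (w ℕ.* w ℕ.+ toℕ y) (toℕ x) (mk≈ (subst (+ p ∣_) (trans (lem (ι x) (ι y) (+ w)) (cong (_- ι x) (sym w²+y≡)))
                                                          (∣m⇒∣-m p∣)))))
          where
            w<p = ℕₚ.≤-<-trans w≤d d<p
            w²+y≡ : + (w ℕ.* w ℕ.+ toℕ y) ≡ + w * + w + ι y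
            w²+y≡ = trans (ℤₚ.pos-+ (w ℕ.* w) (toℕ y)) (cong (_+ ι y) (ℤₚ.pos-* w w))

    record Character (S T : Subset p) : Set where
      field
        σ       : ℤ
        σ-sign  : IsSign σ
        χ≈σ     : ∀ x y → x ∈ S → y ∈ T → x ≢ y → (ι x - ι y) ^ d ≈ σ

    homogeneous-character : ∀ {S T} → Homogeneous p S T → Character S T
    homogeneous-character (inj₁ squares) = record
      { σ = + 1 ; σ-sign = plus ; χ≈σ = λ x y x∈S y∈T x≢y → square-character x y x≢y (squares x y x∈S y∈T x≢y) }
    homogeneous-character (inj₂ nonsquares) = record
      { σ = - + 1 ; σ-sign = minus ; χ≈σ = λ x y x∈S y∈T x≢y → nonsquare-character x y x≢y (nonsquares x y x∈S y∈T x≢y) }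

    flip-power : ∀ a b → (b - a) ^ d ≡ (- + 1) ^ d * (a - b) ^ d
    flip-power a b = trans (cong (_^ d) (lem a b)) (^-distribʳ-* (- + 1) (a - b) d)
      where lem : ∀ a b → b - a ≡ - + 1 * (a - b)
            lem = solve-∀

    minus-one-residue : ∀ {A} → Character A A → 2 ℕ.≤ ∣ A ∣ → (- + 1) ^ d ≈ + 1
    minus-one-residue {A} c 2≤A with two-elements A 2≤A
    ... | a₁ , a₂ , a₁∈A , a₂∈A , a₁≢a₂ = ≈-cancelˡ (sign-nonzero σ-sign) (begin
      σ * (- + 1) ^ d                       ≡⟨ ℤₚ.*-comm σ _ ⟩
      (- + 1) ^ d * σ                       ≈⟨ *-cong (≈-refl {(- + 1) ^ d}) (≈-sym (χ≈σ a₁ a₂ a₁∈A a₂∈A a₁≢a₂)) ⟩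
      (- + 1) ^ d * (ι a₁ - ι a₂) ^ d       ≡⟨ sym (flip-power (ι a₁) (ι a₂)) ⟩
      (ι a₂ - ι a₁) ^ d                     ≈⟨ χ≈σ a₂ a₁ a₂∈A a₁∈A (a₁≢a₂ ∘ sym) ⟩
      σ                                     ≡⟨ sym (ℤₚ.*-identityʳ σ) ⟩
      σ * + 1                               ∎)
      where
        open Character c
        open ≈-Reasoning
        sign-nonzero : ∀ {σ} → IsSign σ → ¬ + p ∣ σ
        sign-nonzero {σ} s p∣σ = ∤1 (subst (+ p ∣_) (sign² s) (∣n⇒∣m*n σ p∣σ))

    sign-* : ∀ {σ τ} → IsSign σ → IsSign τ → IsSign (σ * τ)
    sign-* plus  plus  = plus
    sign-* plus  minus = minus
    sign-* minus plus  = minus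
    sign-* minus minus = plus

    module Configuration (A B : Subset p) (disjoint : ∀ x → x ∈ A → x ∉ B) where

      L : List (Fin p)
      L = elements A ++ elements B

      ∈-L : ∀ {f} → f ∈ᴸ L → f ∈ A ⊎ f ∈ B
      ∈-L f∈L = Sum.map (∈-elements A) (∈-elements B) (∈-++⁻ (elements A) f∈L)

      L-distinct : AllPairs _≢_ L
      L-distinct = AllPairsₚ.++⁺ (elements-distinct A) (elements-distinct B)
        (All.tabulate (λ x∈A → All.tabulate (λ y∈B x≡y →
          disjoint _ (∈-elements A x∈A) (subst (_∈ B) (sym x≡y) (∈-elements B y∈B)))))

      length-L : length L ≡ ∣ A ∣ ℕ.+ ∣ B ∣
      length-L = trans (Listₚ.length-++ (elements A)) (cong₂ ℕ._+_ (length-elements A) (length-elements B))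

      points : List (Fin p) → List ℤ
      points = map ι

      points-distinct : ∀ {xs} → AllPairs _≢_ xs → Distinct (points xs)
      points-distinct xs-distinct = AllPairsₚ.map⁺ (AllPairs.map apart-Fin xs-distinct)

      length-points : ∀ xs → length (points xs) ≡ length xs
      length-points = Listₚ.length-map ι

      label : ℤ → Fin p → ℤ
      label ε f with f ∈? B
      ... | yes _ = ε
      ... | no  _ = + 1

      label-A : ∀ ε {f} → f ∈ A → label ε f ≡ + 1
      label-A ε {f} f∈A with f ∈? B
      ... | yes f∈B = ⊥-elim (disjoint f f∈A f∈B)
      ... | no  _   = refl

      label-B : ∀ ε {f} → f ∈ B → label ε f ≡ ε
      label-B ε {f} f∈B with f ∈? B
      ... | yes _   = refl
      ... | no  f∉B = ⊥-elim (f∉B f∈B)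

      labelled : ℤ → List (ℤ × ℤ)
      labelled ε = map (λ f → ι f , label ε f) L

      length-labelled : ∀ ε → length (labelled ε) ≡ ∣ A ∣ ℕ.+ ∣ B ∣
      length-labelled ε = trans (Listₚ.length-map _ L) length-L

      labelled-distinct : ∀ ε → Distinct (map proj₁ (labelled ε))
      labelled-distinct ε = AllPairsₚ.map⁺ (AllPairsₚ.map⁺ (AllPairs.map apart-Fin L-distinct))

      labelled-signed : ∀ {ε} → IsSign ε → Signed (labelled ε)
      labelled-signed {ε} ε-sign = Allₚ.map⁺ (All.tabulate (λ {f} _ → sign² (label-sign f)))
        where
          label-sign : ∀ f → IsSign (label ε f)
          label-sign f with f ∈? B
          ... | yes _ = ε-sign
          ... | no  _ = plus

      labelled-unsigned : Unsigned (labelled (+ 1))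
      labelled-unsigned = Allₚ.map⁺ (All.tabulate (λ {f} _ → unsigned f))
        where
          unsigned : ∀ f → label (+ 1) f ≡ + 1
          unsigned f with f ∈? B
          ... | yes _ = refl
          ... | no  _ = refl

      aligned : ∀ ε {x} α → (∀ f → f ∈ A → x ≢ f → (ι x - ι f) ^ d ≈ α) →
        (∀ f → f ∈ B → x ≢ f → (ι x - ι f) ^ d ≈ α * ε) → Aligned (labelled ε) (ι x)
      aligned ε {x} α χA χB = α , Allₚ.map⁺ (All.tabulate (λ {f} f∈L apart → on-L f f∈L (apart⇒≢ apart)))
        where
          apart⇒≢ : ∀ {f} → Apart (ι x) (ι f) → x ≢ f
          apart⇒≢ {f} apart refl = apart (subst (+ p ∣_) (sym (ℤₚ.+-inverseʳ (ι x))) ∣0)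
          on-L : ∀ f → f ∈ᴸ L → x ≢ f → (ι x - ι f) ^ d ≈ α * label ε f
          on-L f f∈L x≢f with ∈-L f∈L
          ... | inj₁ f∈A = ≈-trans (χA f f∈A x≢f) (≡⇒≈ (sym (trans (cong (α *_) (label-A ε f∈A)) (ℤₚ.*-identityʳ α))))
          ... | inj₂ f∈B = ≈-trans (χB f f∈B x≢f) (≡⇒≈ (cong (α *_) (sym (label-B ε f∈B))))

    module Cases (A B : Subset p) (disjoint : ∀ x → x ∈ A → x ∉ B) (2≤A : 2 ℕ.≤ ∣ A ∣) (2≤B : 2 ℕ.≤ ∣ B ∣)
                 (χA : Character A A) (χAB : Character A B) (χB : Character B B) where

      open Configuration A B disjoint
      open Character χA  renaming (σ to σA;  σ-sign to σA-sign;  χ≈σ to χA≈σA)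
      open Character χAB renaming (σ to σAB; σ-sign to σAB-sign; χ≈σ to χAB≈σAB)
      open Character χB  renaming (σ to σB;  σ-sign to σB-sign;  χ≈σ to χB≈σB)

      χBA≈σAB : ∀ x y → x ∈ B → y ∈ A → x ≢ y → (ι x - ι y) ^ d ≈ σAB
      χBA≈σAB x y x∈B y∈A x≢y = begin
        (ι x - ι y) ^ d                      ≡⟨ flip-power (ι y) (ι x) ⟩
        (- + 1) ^ d * (ι y - ι x) ^ d        ≈⟨ *-cong (minus-one-residue χA 2≤A) (χAB≈σAB y x y∈A x∈B (x≢y ∘ sym)) ⟩
        + 1 * σAB                            ≡⟨ ℤₚ.*-identityˡ σAB ⟩
        σAB                                  ∎
        where open ≈-Reasoning

      -- Equal characters on A - A and B - B: all of A ∪ B is aligned once B is signed by σA σAB.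
      case-σA≡σB : σA ≡ σB → excess ∣ A ∣ ∣ B ∣ ℕ.≤ d
      case-σA≡σB σA≡σB = Sum.[ short , long ]′ (aligned-bound (labelled ε) (points L) (labelled-distinct ε)
        (labelled-signed ε-sign) (points-distinct L-distinct) (Allₚ.map⁺ (All.tabulate aligned-L))
        (subst (2 ℕ.≤_) (sym (length-labelled ε)) (ℕₚ.≤-trans 2≤A (ℕₚ.m≤m+n _ _))))
        where
          ε = σA * σAB
          ε-sign = sign-* σA-sign σAB-sign
          n = ∣ A ∣ ℕ.+ ∣ B ∣
          length-X : length (points L) ≡ n
          length-X = trans (length-points L) length-L
          aligned-L : ∀ {x} → x ∈ᴸ L → Aligned (labelled ε) (ι x)
          aligned-L {x} x∈L with ∈-L x∈L
          ... | inj₁ x∈A = aligned ε σA (λ f f∈A → χA≈σA x f x∈A f∈A)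
            (λ f f∈B x≢f → ≈-trans (χAB≈σAB x f x∈A f∈B x≢f) (≡⇒≈ (sym (square-one-cancelˡ σA σAB (sign² σA-sign)))))
          ... | inj₂ x∈B = aligned ε (σB * ε)
            (λ f f∈A x≢f → ≈-trans (χBA≈σAB x f x∈B f∈A x≢f)
                             (≡⇒≈ (sym (trans (cong (λ σ → σ * (σA * σAB)) (sym σA≡σB)) (square-one-cancelˡ σA σAB (sign² σA-sign))))))
            (λ f f∈B x≢f → ≈-trans (χB≈σB x f x∈B f∈B x≢f)
                             (≡⇒≈ (sym (trans (ℤₚ.*-assoc σB ε ε) (trans (cong (σB *_) (sign² ε-sign)) (ℤₚ.*-identityʳ σB))))))
          short : length (points L) ℕ.* (length (labelled ε) ℕ.∸ 2) ℕ.≤ d ℕ.+ (length (labelled ε) ℕ.∸ 2) →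
            excess ∣ A ∣ ∣ B ∣ ℕ.≤ d
          short bound = excess≤-joint ∣ A ∣ ∣ B ∣ d 2≤A 2≤B
            (subst₂ (λ k s → k ℕ.* (s ℕ.∸ 2) ℕ.≤ d ℕ.+ (s ℕ.∸ 2)) length-X (length-labelled ε) bound)
          long : length (points L) ℕ.* d ℕ.≤ d ℕ.+ d → excess ∣ A ∣ ∣ B ∣ ℕ.≤ d
          long bound = ⊥-elim (joint-long-impossible ∣ A ∣ ∣ B ∣ d 2≤A 2≤B 1≤d
            (subst (λ k → k ℕ.* d ℕ.≤ d ℕ.+ d) length-X bound))

      -- Equal characters on A - B and on A - A (or B - B): A (or B) is aligned with A ∪ B, all signs being 1.
      one-sided : ∀ C → 2 ℕ.≤ ∣ C ∣ →
        (∀ x → x ∈ᴸ elements C → Aligned (labelled (+ 1)) (ι x)) →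
        suc (∣ C ∣ ℕ.* (∣ A ∣ ℕ.+ ∣ B ∣ ℕ.∸ 2)) ℕ.≤ d
      one-sided C 2≤C aligned-C = Sum.[ short , long ]′ (aligned-bound-unsigned (labelled (+ 1))
        (points (elements C)) (labelled-distinct (+ 1)) labelled-unsigned (points-distinct (elements-distinct C))
        (Allₚ.map⁺ (All.tabulate (λ {x} → aligned-C x)))
        (subst (2 ℕ.≤_) (sym (length-labelled (+ 1))) (ℕₚ.≤-trans 2≤A (ℕₚ.m≤m+n _ _))))
        where
          length-X : length (points (elements C)) ≡ ∣ C ∣
          length-X = trans (length-points (elements C)) (length-elements C)
          short : suc (length (points (elements C)) ℕ.* (length (labelled (+ 1)) ℕ.∸ 2)) ℕ.≤ d →
            suc (∣ C ∣ ℕ.* (∣ A ∣ ℕ.+ ∣ B ∣ ℕ.∸ 2)) ℕ.≤ d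
          short = subst₂ (λ k s → suc (k ℕ.* (s ℕ.∸ 2)) ℕ.≤ d) length-X (length-labelled (+ 1))
          long : suc (length (points (elements C)) ℕ.* d) ℕ.≤ d → suc (∣ C ∣ ℕ.* (∣ A ∣ ℕ.+ ∣ B ∣ ℕ.∸ 2)) ℕ.≤ d
          long bound = ⊥-elim (single-long-impossible ∣ C ∣ d (ℕₚ.≤-trans (s≤s z≤n) 2≤C)
            (subst (λ k → suc (k ℕ.* d) ℕ.≤ d) length-X bound))

      case-σAB≡σA : σAB ≡ σA → excess ∣ A ∣ ∣ B ∣ ℕ.≤ d
      case-σAB≡σA σAB≡σA = excess<ˡ ∣ A ∣ ∣ B ∣ d 2≤A 2≤B (one-sided A 2≤A aligned-A)
        where
          aligned-A : ∀ x → x ∈ᴸ elements A → Aligned (labelled (+ 1)) (ι x)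
          aligned-A x x∈ = aligned (+ 1) σA (λ f f∈A → χA≈σA x f (∈-elements A x∈) f∈A)
            (λ f f∈B x≢f → ≈-trans (χAB≈σAB x f (∈-elements A x∈) f∈B x≢f) (≡⇒≈ (trans σAB≡σA (sym (ℤₚ.*-identityʳ σA)))))

      case-σAB≡σB : σAB ≡ σB → excess ∣ A ∣ ∣ B ∣ ℕ.≤ d
      case-σAB≡σB σAB≡σB = excess<ʳ ∣ A ∣ ∣ B ∣ d 2≤A 2≤B (one-sided B 2≤B aligned-B)
        where
          aligned-B : ∀ x → x ∈ᴸ elements B → Aligned (labelled (+ 1)) (ι x)
          aligned-B x x∈ = aligned (+ 1) σB (λ f f∈A x≢f → ≈-trans (χBA≈σAB x f (∈-elements B x∈) f∈A x≢f) (≡⇒≈ σAB≡σB))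
            (λ f f∈B x≢f → ≈-trans (χB≈σB x f (∈-elements B x∈) f∈B x≢f) (≡⇒≈ (sym (ℤₚ.*-identityʳ σB))))

      excess≤d : excess ∣ A ∣ ∣ B ∣ ℕ.≤ d
      excess≤d = by-cases (σA ℤ.≟ σB)
        where
          by-cases : Dec (σA ≡ σB) → excess ∣ A ∣ ∣ B ∣ ℕ.≤ d
          by-cases (yes σA≡σB) = case-σA≡σB σA≡σB
          by-cases (no  σA≢σB) = Sum.[ case-σAB≡σA , case-σAB≡σB ]′ (sign-pigeonhole σA-sign σB-sign σAB-sign σA≢σB)

  full-subset-of-Fin2 : (A : Subset 2) → 2 ℕ.≤ ∣ A ∣ → Fin.zero ∈ A
  full-subset-of-Fin2 (true  ∷ _ ∷ [])    _             = here
  full-subset-of-Fin2 (false ∷ true ∷ []) (s≤s ())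
  full-subset-of-Fin2 (false ∷ false ∷ []) ()

  no-disjoint-pairs-in-Fin2 : ∀ {p} → p ≡ 2 → (A B : Subset p) → (∀ x → x ∈ A → x ∉ B) →
    2 ℕ.≤ ∣ A ∣ → 2 ℕ.≤ ∣ B ∣ → ⊥
  no-disjoint-pairs-in-Fin2 refl A B disjoint 2≤A 2≤B = disjoint Fin.zero (full-subset-of-Fin2 A 2≤A) (full-subset-of-Fin2 B 2≤B)

  odd-prime : ∀ p → Prime p → (A B : Subset p) → (∀ x → x ∈ A → x ∉ B) → 2 ℕ.≤ ∣ A ∣ → 2 ℕ.≤ ∣ B ∣ →
    p ≡ suc (p ℕ./ 2 ℕ.+ p ℕ./ 2)
  odd-prime p p-prime A B disjoint 2≤A 2≤B = by-parity (p % 2) (m%n<n p 2) (m≡m%n+[m/n]*n p 2)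
    where
      half = p ℕ./ 2
      even : ∀ h → p ≡ h ℕ.* 2 → ⊥
      even zero          p≡0  = ℕₚ.n≮0 (subst (1 ℕ.<_) p≡0 (ℕ.nonTrivial⇒n>1 p {{prime⇒nonTrivial p-prime}}))
      even (suc zero)    p≡2  = no-disjoint-pairs-in-Fin2 p≡2 A B disjoint 2≤A 2≤B
      even (suc (suc k)) p≡2h = composite⇒¬prime (composite {2} 2<p (ℕᵈ.divides (suc (suc k)) p≡2h)) p-prime
        where
          2<p : 2 ℕ.< p
          2<p = subst (2 ℕ.<_) (sym p≡2h) (s≤s (s≤s (s≤s z≤n)))
      by-parity : ∀ r → r ℕ.< 2 → p ≡ r ℕ.+ half ℕ.* 2 → p ≡ suc (half ℕ.+ half)
      by-parity 0             _                p≡ = ⊥-elim (even half p≡)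
      by-parity 1             _                p≡ = trans p≡ (cong suc (trans (ℕₚ.*-comm half 2) (cong (half ℕ.+_) (ℕₚ.+-identityʳ half))))
      by-parity (suc (suc _)) (s≤s (s≤s ())) _

open import Data.Nat using (_+_; _*_; _∸_; _⊓_; _≤_; NonZero)
open import Data.Fin.Subset using (Subset; _∈_; _∉_; ∣_∣)

corollary4 : (p : ℕ) .{{_ : NonZero p}} → Prime p → (A B : Subset p) →
    (∀ x → x ∈ A → x ∉ B) → 2 ≤ ∣ A ∣ → 2 ≤ ∣ B ∣ →
    Homogeneous p A A → Homogeneous p A B → Homogeneous p B B →
    2 * (((∣ A ∣ * ∣ A ∣ ∸ 2 * ∣ A ∣) ⊓ (∣ B ∣ * ∣ B ∣ ∸ 2 * ∣ B ∣)) + ∣ A ∣ * ∣ B ∣ + 2) ≤ p + 3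
corollary4 p p-prime A B disjoint 2≤A 2≤B A-A A-B B-B =
  subst (λ q → 2 * (excess ∣ A ∣ ∣ B ∣ + 2) ≤ q + 3) (sym p≡2d+1)
    (excess-conclusion (excess ∣ A ∣ ∣ B ∣) d (Cases.excess≤d A B disjoint 2≤A 2≤B
      (homogeneous-character A-A) (homogeneous-character A-B) (homogeneous-character B-B)))
  where
    d = p ℕ./ 2
    p≡2d+1 = odd-prime p p-prime A B disjoint 2≤A 2≤B
    open DifferenceSets p p-prime d p≡2d+1
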